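{- Let $k\ge 3$ and let $G$ be a connected $n$-vertex graph with a $(k,1)$-cover, where $n-k=q(k-1)+r$ with integers $q\ge 0$ and $1\le r\le k-1$. Then the number of edges of $G$ is at least $(q+2)\binom{k}{2}-\binom{k-r}{2}$. Moreover, equality holds if and only if $G\in\mathcal{G}_{tree}(qK_k,L)$, where $L$ is the graph formed by the union of two copies of $K_k$ sharing exactly $k-r$ vertices.
   Context: A graph $G$ has a $(k,\ell)$-cover if every edge of $G$ lies in at least $\ell$ copies of $K_k$ (subgraphs isomorphic to the complete graph on $k$ vertices). A hypergraph is linear if any two distinct hyperedges share at most one vertex. In a hypergraph, a cycle of length $\ell\ge 2$ is a set of $\ell$ hyperedges labelled $e_1,\dots,e_\ell$ for which there exist distinct vertices $v_1,\dots,v_\ell$ with $v_i\in e_i\cap e_{i+1}$ for all $i\in[\ell]$ (where $e_{\ell+1}=e_1$); a hypertree is a connected hypergraph with no cycle. For graphs $F_1,\dots,F_m$, $\mathcal{G}_{tree}(F_1,\dots,F_m)$ is the family of graphs $G$ for which there is a linear hypertree with vertex set $V(G)$ and $m$ hyperedges $E_1,\dots,E_m\subseteq V(G)$ such that (1) for every edge $uv\in E(G)$ there is $i\in[m]$ with $u,v\in E_i$, and (2) for every $i\in[m]$ the induced subgraph $G[E_i]$ is isomorphic to $F_i$. The notation $\mathcal{G}_{tree}(qK_k,L)$ means $\mathcal{G}_{tree}(F_1,\dots,F_{q+1})$ with $F_1=\dots=F_q=K_k$ and $F_{q+1}=L$. -}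

module Defs where

open import Data.Nat using (ℕ; zero; suc; _+_; _*_; _∸_; _≤_; _<_; _<ᵇ_)
open import Data.Nat.DivMod using (_mod_)
open import Data.Nat.Combinatorics using (_C_)
open import Data.Bool using (Bool; true; false; _∧_; _∨_; not; if_then_else_)
open import Data.Fin using (Fin; toℕ; fromℕ; _≟_)
open import Data.Fin.Subset using (Subset; _∈_; _∩_; ∣_∣)
open import Data.List using (List; map; allFin)
open import Data.Nat.ListAction using (sum)
open import Data.Product using (Σ; ∃; _×_; _,_)
open import Function.Definitions using (Injective)
open import Relation.Binary.PropositionalEquality using (_≡_)
open import Relation.Nullary using (¬_; yes; no)
open import Function.Bundles using (_⇔_)

record Graph (n : ℕ) : Set where
  field
    adj   : Fin n → Fin n → Bool
    adj-sym   : ∀ u v → adj u v ≡ adj v u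
    adj-irref : ∀ u → adj u u ≡ false
open Graph public

record SGraph : Set where
  constructor sgraph
  field
    size  : ℕ
    graph : Graph size
open SGraph public

edgeCount : ∀ {n} → Graph n → ℕ
edgeCount {n} G =
  sum (map (λ i → sum (map (λ j → if (toℕ i <ᵇ toℕ j) ∧ adj G i j then 1 else 0)
                              (allFin n)))
           (allFin n))

data Walk {n} (G : Graph n) : Fin n → Fin n → Set where
  here : ∀ {u} → Walk G u u
  step : ∀ {u w v} → adj G u w ≡ true → Walk G w v → Walk G u v

Connected : ∀ {n} → Graph n → Set
Connected {n} G = ∀ (u v : Fin n) → Walk G u v

IsCliqueCopy : ∀ {n} (k : ℕ) → Graph n → (Fin k → Fin n) → Set
IsCliqueCopy k G f =
  Injective _≡_ _≡_ f × (∀ a b → ¬ a ≡ b → adj G (f a) (f b) ≡ true)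

HasK1Cover : ∀ {n} (k : ℕ) → Graph n → Set
HasK1Cover {n} k G = ∀ (u v : Fin n) → adj G u v ≡ true →
  Σ (Fin k → Fin n) λ f → IsCliqueCopy k G f ×
    ((Σ (Fin k) λ a → f a ≡ u) × (Σ (Fin k) λ b → f b ≡ v))

K : ℕ → SGraph
K k = sgraph k record
  { adj = λ a b → not (eqb a b)
  ; adj-sym = λ a b → symb a b
  ; adj-irref = λ a → irrb a }
  where
  eqb : Fin k → Fin k → Bool
  eqb a b with a ≟ b
  ... | yes _ = true
  ... | no _ = false
  open import Relation.Binary.PropositionalEquality using (refl; sym)
  symb : ∀ a b → not (eqb a b) ≡ not (eqb b a)
  symb a b with a ≟ b | b ≟ a
  ... | yes _ | yes _ = refl
  ... | no _  | no _  = refl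
  ... | yes p | no q  = Data.Empty.⊥-elim (q (sym p))
    where import Data.Empty
  ... | no p  | yes q = Data.Empty.⊥-elim (p (sym q))
    where import Data.Empty
  irrb : ∀ a → not (eqb a a) ≡ false
  irrb a with a ≟ a
  ... | yes _ = refl
  ... | no p = Data.Empty.⊥-elim (p refl)
    where import Data.Empty

-- L k r: two copies of K_k sharing exactly k - r vertices (for 1 ≤ r ≤ k-1).
-- Vertex set Fin (k + r); the first copy is {0,…,k-1}, the second {r,…,k+r-1}.
L : ℕ → ℕ → SGraph
L k r = sgraph (k + r) record
  { adj = λ a b → adjK a b ∧ ((inA a ∧ inA b) ∨ (inB a ∧ inB b))
  ; adj-sym = λ a b → symL a b
  ; adj-irref = λ a → irrL a }
  where
  open import Relation.Binary.PropositionalEquality using (refl; sym; cong₂)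
  open import Data.Bool.Properties using (∧-comm)
  KK = K (k + r)
  adjK = adj (graph KK)
  inA : Fin (k + r) → Bool
  inA a = toℕ a <ᵇ k
  inB : Fin (k + r) → Bool
  inB a = r <ᵇ suc (toℕ a)
  symL : ∀ a b → (adjK a b ∧ ((inA a ∧ inA b) ∨ (inB a ∧ inB b)))
               ≡ (adjK b a ∧ ((inA b ∧ inA a) ∨ (inB b ∧ inB a)))
  symL a b = cong₂ _∧_ (adj-sym (graph KK) a b)
               (cong₂ _∨_ (∧-comm (inA a) (inA b)) (∧-comm (inB a) (inB b)))
  irrL : ∀ a → (adjK a a ∧ ((inA a ∧ inA a) ∨ (inB a ∧ inB a))) ≡ false
  irrL a rewrite adj-irref (graph KK) a = refl

Hyperedges : ℕ → ℕ → Set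
Hyperedges n m = Fin m → Subset n

Linear : ∀ {n m} → Hyperedges n m → Set
Linear {n} {m} E = ∀ (i j : Fin m) → ¬ i ≡ j → ∣ E i ∩ E j ∣ ≤ 1

data HWalk {n m} (E : Hyperedges n m) : Fin n → Fin n → Set where
  here : ∀ {u} → HWalk E u u
  step : ∀ {u w v} (i : Fin m) → u ∈ E i → w ∈ E i → HWalk E w v → HWalk E u v

HConnected : ∀ {n m} → Hyperedges n m → Set
HConnected {n} E = ∀ (u v : Fin n) → HWalk E u v

next : ∀ {l} → Fin (suc l) → Fin (suc l)
next {l} i = suc (toℕ i) mod (suc l)

HCycle : ∀ {n m} → Hyperedges n m → Set
HCycle {n} {m} E = Σ ℕ λ l → 1 ≤ l ×
  (Σ (Fin (suc l) → Fin m) λ c → Σ (Fin (suc l) → Fin n) λ v →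
     Injective _≡_ _≡_ c × Injective _≡_ _≡_ v ×
     (∀ i → (v i ∈ E (c i)) × (v i ∈ E (c (next i)))))

Hypertree : ∀ {n m} → Hyperedges n m → Set
Hypertree E = HConnected E × ¬ HCycle E

InducedIso : ∀ {n} → Graph n → Subset n → SGraph → Set
InducedIso {n} G S F =
  Σ (Fin (size F) → Fin n) λ f →
    Injective _≡_ _≡_ f ×
    (∀ a → f a ∈ S) ×
    (∀ x → x ∈ S → Σ (Fin (size F)) λ a → f a ≡ x) ×
    (∀ a b → adj (graph F) a b ≡ adj G (f a) (f b))

InGtree : ∀ {n} (m : ℕ) → (Fin m → SGraph) → Graph n → Set
InGtree {n} m F G = Σ (Hyperedges n m) λ E →
  Linear E × Hypertree E ×
  (∀ (u v : Fin n) → adj G u v ≡ true → Σ (Fin m) λ i → (u ∈ E i) × (v ∈ E i)) ×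
  (∀ i → InducedIso G (E i) (F i))

famQKL : (q k r : ℕ) → Fin (suc q) → SGraph
famQKL q k r i with i ≟ fromℕ q
... | yes _ = L k r
... | no _  = K k

-- Grow a vertex set S from one copy of K_k, k = K + 1.  While S is not everything, connectivity gives
-- an edge leaving S, and a copy C of K_k through it adds t ≥ 1 new vertices and at least
-- C(t,2) + (k - t) t new edges.  Writing |S| = 1 + a K + s with 1 ≤ s ≤ K, the potential
-- minEdges K a s = a C(k,2) + C(s,2) + (k - s) s (the edge count of the extremal graphs of that order)
-- never grows by more than the edges gained, so e(G) ≥ minEdges K (q + 1) r, the claimed bound.
--
-- If equality holds, no step loses anything: every new edge lies inside C, and a step from s < K
-- must add t = K new vertices.  So each clique meets the earlier ones in a single vertex, except the
-- first one with t < K (or, failing that, the last one): it meets a single earlier clique in k - t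
-- vertices, and the two form a copy of L.  Listing the cliques newest first, each meets the union of
-- the older ones in at most one vertex, which makes them the blocks of a linear hypertree.
-- Conversely, in a graph of 𝒢_tree(qK_k, L) linearity makes the blocks partition the edges, so
-- e(G) = q C(k,2) + e(L).

module Submission where

open import Defs
open import Data.Bool using (Bool; true; false; not; _∧_; _∨_; if_then_else_)
import Data.Bool as Bool
open import Data.Bool.Properties
  using (¬-not; ∧-zeroʳ; ∧-identityʳ; ∧-comm; ∧-conicalˡ; ∧-conicalʳ; ∨-zeroʳ; ∨-identityʳ)
open import Data.Empty using (⊥; ⊥-elim)
open import Data.Fin using (Fin; zero; suc; toℕ; fromℕ; fromℕ<; inject₁; punchIn; _≟_)
open import Data.Fin.Permutation using (Permutation; transpose; _⟨$⟩ʳ_; _⟨$⟩ˡ_; inverseˡ; inverseʳ)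
import Data.Fin.Permutation.Components as PC
open import Data.Fin.Properties
  using (any?; punchInᵢ≢i; fromℕ<-injective; toℕ-fromℕ<; toℕ-fromℕ; toℕ-inject₁; toℕ<n; toℕ-injective)
import Data.Fin.Properties as Finₚ
open import Data.Fin.Subset using (Subset; _∈_; _∩_; ∣_∣)
open import Data.Fin.Subset.Properties using (x∈p∩q⁺; x∈p∩q⁻)
open import Data.List using (map; allFin)
import Data.List as List
open import Data.List.Properties using (map-tabulate)
open import Data.Nat using (ℕ; zero; suc; _+_; _*_; _∸_; _≤_; _<_; _<ᵇ_; z≤n; s≤s; _≤?_; _<?_)
  renaming (_≟_ to _≟ℕ_)
open import Data.Nat.Combinatorics using (_C_; nCk+nC[k+1]≡[n+1]C[k+1]; nC1≡n)
open import Data.Nat.DivMod using (_%_; m<n⇒m%n≡m; n%n≡0)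
import Data.Nat.ListAction as ListAction
open import Data.Nat.Properties hiding (_≟_)
open import Algebra.Properties.CommutativeMonoid.Sum +-0-commutativeMonoid
  using (sum; sum-cong-≗; ∑-distrib-+; ∑-comm; sum-remove; sum-replicate-zero)
open import Algebra.Properties.CommutativeSemigroup +-commutativeSemigroup using (interchange)
open import Data.Nat.Tactic.RingSolver using (solve-∀)
open import Data.Product using (Σ; ∃; _×_; _,_; proj₁; proj₂)
open import Data.Sum using (_⊎_; inj₁; inj₂)
open import Data.Vec using ([]; _∷_; lookup; tabulate)
open import Data.Vec.Functional using () renaming (_∷_ to _∷ᶠ_)
open import Data.Vec.Properties using (lookup∘tabulate; []=⇒lookup; lookup⇒[]=)
open import Function using (_∘_; _∘′_)
open import Function.Bundles using (_⇔_; mk⇔)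
open import Function.Definitions using (Injective)
open import Relation.Binary.Definitions using (tri<; tri≈; tri>)
open import Relation.Binary.PropositionalEquality
open import Relation.Nullary using (¬_; Dec; yes; no; does; contradiction; _×-dec_)
open import Relation.Nullary.Decidable using (dec-true; dec-false)

private variable m n : ℕ

-- Finite sums and counting

χ : Bool → ℕ
χ true = 1
χ false = 0

χ≤1 : ∀ b → χ b ≤ 1
χ≤1 true = ≤-refl
χ≤1 false = z≤n

χ-if : ∀ b → (if b then 1 else 0) ≡ χ b
χ-if true = refl
χ-if false = refl

from-does : ∀ {a} {A : Set a} (a? : Dec A) → does a? ≡ true → A
from-does (yes a) _ = a

sum-mono-≤ : {f g : Fin n → ℕ} → (∀ i → f i ≤ g i) → sum f ≤ sum g
sum-mono-≤ {zero} le = z≤n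
sum-mono-≤ {suc n} le = +-mono-≤ (le zero) (sum-mono-≤ (le ∘ suc))

sum-zero : (f : Fin n → ℕ) → (∀ i → f i ≡ 0) → sum f ≡ 0
sum-zero {n} f f≡0 = trans (sum-cong-≗ f≡0) (sum-replicate-zero n)

sum-ones : ∀ n → sum {n} (λ _ → 1) ≡ n
sum-ones zero = refl
sum-ones (suc n) = cong suc (sum-ones n)

≤-sum : (f : Fin n → ℕ) (i : Fin n) → f i ≤ sum f
≤-sum {suc n} f i = ≤-trans (m≤m+n (f i) _) (≤-reflexive (sym (sum-remove {i = i} f)))

sum-single : (f : Fin n → ℕ) (i : Fin n) → (∀ j → ¬ j ≡ i → f j ≡ 0) → sum f ≡ f i
sum-single {suc n} f i others = begin
  sum f                                 ≡⟨ sum-remove {i = i} f ⟩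
  f i + sum (λ j → f (punchIn i j))     ≡⟨ cong (f i +_) (sum-zero _ λ j → others _ (punchInᵢ≢i i j)) ⟩
  f i + 0                               ≡⟨ +-identityʳ (f i) ⟩
  f i                                   ∎
  where open ≡-Reasoning

sum-δ : (x : Fin n) (h : Fin n → ℕ) → sum (λ y → if does (x ≟ y) then h y else 0) ≡ h x
sum-δ x h = trans (sum-single _ x λ y y≢x → cong (λ b → if b then h y else 0) (dec-false (x ≟ y) (y≢x ∘ sym)))
                  (cong (λ b → if b then h x else 0) (dec-true (x ≟ x) refl))

module _ (f : Fin m → Fin n) (f-inj : Injective _≡_ _≡_ f) (X : Fin n → Bool)
         (onto : ∀ x → X x ≡ true → ∃ λ a → f a ≡ x) (into : ∀ a → X (f a) ≡ true) where

  private
    fibre : ∀ (h : Fin n → ℕ) x → (if X x then h x else 0) ≡ sum (λ a → if does (f a ≟ x) then h x else 0)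
    fibre h x with X x in Xx
    ... | true with onto x Xx
    ...   | a , refl =
      sym (trans (sum-single _ a off) (cong (λ b → if b then h (f a) else 0) (dec-true (f a ≟ f a) refl)))
      where
      off : ∀ b → ¬ b ≡ a → (if does (f b ≟ f a) then h (f a) else 0) ≡ 0
      off b b≢a = cong (λ c → if c then h (f a) else 0) (dec-false (f b ≟ f a) (b≢a ∘ f-inj))
    fibre h x | false = sym (sum-zero _ miss)
      where
      miss : ∀ a → (if does (f a ≟ x) then h x else 0) ≡ 0
      miss a = cong (λ c → if c then h x else 0)
        (dec-false (f a ≟ x) λ { refl → contradiction (trans (sym Xx) (into a)) λ () })

  sum-image : (h : Fin n → ℕ) → sum (λ x → if X x then h x else 0) ≡ sum (λ a → h (f a))
  sum-image h = begin
    sum (λ x → if X x then h x else 0)       ≡⟨ sum-cong-≗ (fibre h) ⟩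
    sum (λ x → sum (λ a → term a x))         ≡⟨ ∑-comm (λ x a → term a x) ⟩
    sum (λ a → sum (λ x → term a x))         ≡⟨ sum-cong-≗ (λ a → sum-δ (f a) h) ⟩
    sum (λ a → h (f a))                      ∎
    where
    open ≡-Reasoning
    term : Fin m → Fin n → ℕ
    term a x = if does (f a ≟ x) then h x else 0

sum-allFin : (f : Fin n → ℕ) → ListAction.sum (map f (allFin n)) ≡ sum f
sum-allFin {n} f = trans (cong ListAction.sum (map-tabulate {n = n} (λ i → i) f)) (sum-tabulate f)
  where
  sum-tabulate : ∀ {n} (f : Fin n → ℕ) → ListAction.sum (List.tabulate f) ≡ sum f
  sum-tabulate {zero} f = refl
  sum-tabulate {suc n} f = cong (f zero +_) (sum-tabulate (f ∘ suc))

choose2 : ℕ → ℕ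
choose2 zero = 0
choose2 (suc n) = n + choose2 n

choose2≡C2 : ∀ n → choose2 n ≡ n C 2
choose2≡C2 zero = refl
choose2≡C2 (suc n) = trans (cong₂ _+_ (sym (nC1≡n n)) (choose2≡C2 n)) (nCk+nC[k+1]≡[n+1]C[k+1] n 1)

choose2-+ : ∀ a b → choose2 (a + b) ≡ choose2 a + choose2 b + a * b
choose2-+ zero b = sym (+-identityʳ _)
choose2-+ (suc a) b rewrite choose2-+ a b = shuffle a b (choose2 a) (choose2 b)
  where
  shuffle : ∀ a b ca cb → a + b + (ca + cb + a * b) ≡ a + ca + cb + (b + a * b)
  shuffle = solve-∀

count : (Fin n → Bool) → ℕ
count X = sum (λ x → χ (X x))

count-cong : {X Y : Fin n → Bool} → (∀ x → X x ≡ Y x) → count X ≡ count Y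
count-cong X≡Y = sum-cong-≗ (cong χ ∘ X≡Y)

count-all : (X : Fin n → Bool) → (∀ x → X x ≡ true) → count X ≡ n
count-all {n} X all = trans (count-cong all) (sum-ones n)

count≤n : (X : Fin n → Bool) → count X ≤ n
count≤n {n} X = ≤-trans (sum-mono-≤ (χ≤1 ∘ X)) (≤-reflexive (sum-ones n))

count<n : (X : Fin n → Bool) (x : Fin n) → X x ≡ false → count X < n
count<n {suc n} X zero Xx rewrite Xx = s≤s (count≤n (X ∘ suc))
count<n {suc n} X (suc x) Xx =
  ≤-trans (≤-reflexive (sym (+-suc (χ (X zero)) _))) (+-mono-≤ (χ≤1 (X zero)) (count<n (X ∘ suc) x Xx))

count-split : (X Y : Fin n → Bool) → count X ≡ count (λ x → X x ∧ Y x) + count (λ x → X x ∧ not (Y x))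
count-split X Y =
  trans (sum-cong-≗ pointwise) (∑-distrib-+ (λ x → χ (X x ∧ Y x)) (λ x → χ (X x ∧ not (Y x))))
  where
  pointwise : ∀ x → χ (X x) ≡ χ (X x ∧ Y x) + χ (X x ∧ not (Y x))
  pointwise x with X x | Y x
  ... | true | true = refl
  ... | true | false = refl
  ... | false | _ = refl

count-∨ : (X Y : Fin n → Bool) → count (λ x → X x ∨ Y x) ≡ count X + count (λ x → Y x ∧ not (X x))
count-∨ X Y = trans (sum-cong-≗ λ x → χ-∨ (X x) (Y x)) (∑-distrib-+ (χ ∘ X) (λ x → χ (Y x ∧ not (X x))))
  where
  χ-∨ : ∀ a b → χ (a ∨ b) ≡ χ a + χ (b ∧ not a)
  χ-∨ true b rewrite ∧-zeroʳ b = refl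
  χ-∨ false b rewrite ∧-identityʳ b = refl

count-pos : (X : Fin n → Bool) (x : Fin n) → X x ≡ true → 1 ≤ count X
count-pos X x Xx = subst (_≤ count X) (cong χ Xx) (≤-sum (χ ∘ X) x)

count-nonempty : (X : Fin n → Bool) → 1 ≤ count X → ∃ λ x → X x ≡ true
count-nonempty {suc n} X pos with X zero in X0
... | true = zero , X0
... | false with count-nonempty (X ∘ suc) pos
...   | x , Xx = suc x , Xx

count≤1 : (X : Fin n → Bool) → (∀ x y → X x ≡ true → X y ≡ true → x ≡ y) → count X ≤ 1
count≤1 {zero} X unique = z≤n
count≤1 {suc n} X unique with X zero in X0
... | true = ≤-reflexive (cong suc (sum-zero _ rest))
  where
  rest : ∀ i → χ (X (suc i)) ≡ 0
  rest i with X (suc i) in Xi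
  ... | true with unique zero (suc i) X0 Xi
  ...   | ()
  rest i | false = refl
... | false = count≤1 (X ∘ suc) λ x y Xx Xy → Finₚ.suc-injective (unique (suc x) (suc y) Xx Xy)

count≤1⇒unique : (X : Fin n → Bool) → count X ≤ 1 → ∀ x y → X x ≡ true → X y ≡ true → x ≡ y
count≤1⇒unique {suc n} X le zero zero Xx Xy = refl
count≤1⇒unique {suc n} X le zero (suc y) Xx Xy rewrite Xx =
  ⊥-elim (1+n≰n (≤-trans (s≤s (count-pos (X ∘ suc) y Xy)) le))
count≤1⇒unique {suc n} X le (suc x) zero Xx Xy rewrite Xy =
  ⊥-elim (1+n≰n (≤-trans (s≤s (count-pos (X ∘ suc) x Xx)) le))
count≤1⇒unique {suc n} X le (suc x) (suc y) Xx Xy =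
  cong suc (count≤1⇒unique (X ∘ suc) (≤-trans (m≤n+m _ (χ (X zero))) le) x y Xx Xy)

full-or-missing : (X : Fin n → Bool) → (∀ x → X x ≡ true) ⊎ (∃ λ x → X x ≡ false)
full-or-missing X with any? (λ x → X x Bool.≟ false)
... | yes missing = inj₂ missing
... | no none = inj₁ λ x → ¬-not λ Xx → none (x , Xx)

count-image : (f : Fin m → Fin n) → Injective _≡_ _≡_ f → (X : Fin n → Bool) →
  (∀ x → X x ≡ true → ∃ λ a → f a ≡ x) → (∀ a → X (f a) ≡ true) → count X ≡ m
count-image {m} f f-inj X onto into = begin
  sum (λ x → χ (X x))                   ≡⟨ sum-cong-≗ (sym ∘ χ-if ∘ X) ⟩
  sum (λ x → if X x then 1 else 0)      ≡⟨ sum-image f f-inj X onto into (λ _ → 1) ⟩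
  sum {m} (λ _ → 1)                     ≡⟨ sum-ones m ⟩
  m                                     ∎
  where open ≡-Reasoning

X⊆Y∧∣Y∣≤∣X∣⇒Y⊆X : (X Y : Fin n → Bool) → (∀ x → X x ≡ true → Y x ≡ true) → count Y ≤ count X →
  ∀ x → Y x ≡ true → X x ≡ true
X⊆Y∧∣Y∣≤∣X∣⇒Y⊆X X Y X⊆Y ∣Y∣≤∣X∣ x Yx =
  ¬-not λ Xx → contradiction (≤-trans (count-pos Y∖X x (cong₂ _∧_ Yx (cong not Xx))) Y∖X-empty) λ ()
  where
  Y∖X : Fin _ → Bool
  Y∖X x = Y x ∧ not (X x)
  Y∩X≡X : ∀ x → (Y x ∧ X x) ≡ X x
  Y∩X≡X x with X x in Xx
  ... | true = cong (_∧ true) (X⊆Y x Xx)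
  ... | false = ∧-zeroʳ (Y x)
  Y∖X-empty : count Y∖X ≤ 0
  Y∖X-empty = +-cancelˡ-≤ (count X) (count Y∖X) 0 (begin
    count X + count Y∖X                  ≡⟨ cong (_+ count Y∖X) (count-cong Y∩X≡X) ⟨
    count (λ x → Y x ∧ X x) + count Y∖X  ≡⟨ count-split Y X ⟨
    count Y                              ≤⟨ ∣Y∣≤∣X∣ ⟩
    count X                              ≡⟨ +-identityʳ (count X) ⟨
    count X + 0                          ∎)
    where open ≤-Reasoning

injection-onto : (f : Fin m → Fin n) → Injective _≡_ _≡_ f → (Y : Fin n → Bool) → (∀ a → Y (f a) ≡ true) →
  count Y ≤ m → ∀ x → Y x ≡ true → ∃ λ a → f a ≡ x
injection-onto {m} f f-inj Y into ∣Y∣≤m x Yx =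
  from-does (any? λ a → f a ≟ x)
    (X⊆Y∧∣Y∣≤∣X∣⇒Y⊆X image Y image⊆Y (subst (count Y ≤_) (sym count-image′) ∣Y∣≤m) x Yx)
  where
  image : Fin _ → Bool
  image y = does (any? λ a → f a ≟ y)
  image⊆Y : ∀ y → image y ≡ true → Y y ≡ true
  image⊆Y y hit with from-does (any? λ a → f a ≟ y) hit
  ... | a , refl = into a
  count-image′ : count image ≡ m
  count-image′ = count-image f f-inj image (λ y → from-does (any? λ a → f a ≟ y))
                                           (λ a → dec-true (any? λ b → f b ≟ f a) (a , refl))

enum : (X : Fin n → Bool) → Fin (count X) → Fin n
enum {suc n} X i with X zero
enum {suc n} X zero    | true = zero
enum {suc n} X (suc i) | true = suc (enum (X ∘ suc) i)
enum {suc n} X i       | false = suc (enum (X ∘ suc) i)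

enum-member : (X : Fin n → Bool) (i : Fin (count X)) → X (enum X i) ≡ true
enum-member {suc n} X i with X zero in X0
enum-member {suc n} X zero    | true = X0
enum-member {suc n} X (suc i) | true = enum-member (X ∘ suc) i
enum-member {suc n} X i       | false = enum-member (X ∘ suc) i

enum-injective : (X : Fin n → Bool) → Injective _≡_ _≡_ (enum X)
enum-injective {suc n} X {i} {j} eq with X zero
enum-injective {suc n} X {zero}  {zero}  eq | true = refl
enum-injective {suc n} X {suc i} {suc j} eq | true = cong suc (enum-injective (X ∘ suc) (Finₚ.suc-injective eq))
enum-injective {suc n} X {i}     {j}     eq | false = enum-injective (X ∘ suc) (Finₚ.suc-injective eq)

pick : (X : Fin n → Bool) (i : ℕ) → .(i < count X) → Fin n
pick X i i<count = enum X (fromℕ< i<count)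

pick-member : (X : Fin n → Bool) (i : ℕ) .(i<count : i < count X) → X (pick X i i<count) ≡ true
pick-member X i i<count = enum-member X (fromℕ< i<count)

pick-injective : (X : Fin n → Bool) (i j : ℕ) .(i<count : i < count X) .(j<count : j < count X) →
  pick X i i<count ≡ pick X j j<count → i ≡ j
pick-injective X i j i<count j<count eq = fromℕ<-injective i j i<count j<count (enum-injective X eq)

sumPairs : (Fin n → Fin n → ℕ) → ℕ
sumPairs {zero} P = 0
sumPairs {suc n} P = sum (λ j → P zero (suc j)) + sumPairs (λ i j → P (suc i) (suc j))

private
  off-diagonal-suc : ∀ {P : Fin (suc n) → Fin (suc n) → Set} →
    (∀ i j → ¬ i ≡ j → P i j) → ∀ i j → ¬ i ≡ j → P (suc i) (suc j)
  off-diagonal-suc h i j i≢j = h (suc i) (suc j) (i≢j ∘ Finₚ.suc-injective)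

sumPairs-cong : {P Q : Fin n → Fin n → ℕ} → (∀ i j → ¬ i ≡ j → P i j ≡ Q i j) → sumPairs P ≡ sumPairs Q
sumPairs-cong {zero} h = refl
sumPairs-cong {suc n} h =
  cong₂ _+_ (sum-cong-≗ λ j → h zero (suc j) λ ()) (sumPairs-cong (off-diagonal-suc h))

sumPairs-mono-≤ : {P Q : Fin n → Fin n → ℕ} → (∀ i j → ¬ i ≡ j → P i j ≤ Q i j) → sumPairs P ≤ sumPairs Q
sumPairs-mono-≤ {zero} h = z≤n
sumPairs-mono-≤ {suc n} h =
  +-mono-≤ (sum-mono-≤ λ j → h zero (suc j) λ ()) (sumPairs-mono-≤ (off-diagonal-suc h))

sumPairs-+ : (P Q : Fin n → Fin n → ℕ) → sumPairs (λ i j → P i j + Q i j) ≡ sumPairs P + sumPairs Q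
sumPairs-+ {zero} P Q = refl
sumPairs-+ {suc n} P Q
  rewrite ∑-distrib-+ (λ j → P zero (suc j)) (λ j → Q zero (suc j))
        | sumPairs-+ (λ i j → P (suc i) (suc j)) (λ i j → Q (suc i) (suc j)) =
  interchange (sum (λ j → P zero (suc j))) (sum (λ j → Q zero (suc j)))
              (sumPairs (λ i j → P (suc i) (suc j))) (sumPairs (λ i j → Q (suc i) (suc j)))

sumPairs-zero : ∀ n → sumPairs {n} (λ _ _ → 0) ≡ 0
sumPairs-zero zero = refl
sumPairs-zero (suc n) = cong₂ _+_ (sum-replicate-zero n) (sumPairs-zero n)

sumPairs-sum : (P : Fin m → Fin n → Fin n → ℕ) →
  sumPairs (λ u v → sum (λ i → P i u v)) ≡ sum (λ i → sumPairs (P i))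
sumPairs-sum {zero} {n} P = sumPairs-zero n
sumPairs-sum {suc m} P =
  trans (sumPairs-+ (P zero) (λ u v → sum (λ i → P (suc i) u v)))
        (cong (sumPairs (P zero) +_) (sumPairs-sum (P ∘ suc)))

≤-sumPairs : (P : Fin n → Fin n → ℕ) → (∀ i j → P i j ≡ P j i) → ∀ u v → ¬ u ≡ v → P u v ≤ sumPairs P
≤-sumPairs P P-sym zero zero u≢v = contradiction refl u≢v
≤-sumPairs P P-sym zero (suc v) u≢v = ≤-trans (≤-sum (λ j → P zero (suc j)) v) (m≤m+n _ _)
≤-sumPairs P P-sym (suc u) zero u≢v =
  ≤-trans (≤-reflexive (P-sym (suc u) zero)) (≤-trans (≤-sum (λ j → P zero (suc j)) u) (m≤m+n _ _))
≤-sumPairs P P-sym (suc u) (suc v) u≢v =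
  ≤-trans (≤-sumPairs (λ i j → P (suc i) (suc j)) (λ i j → P-sym (suc i) (suc j)) u v (u≢v ∘ cong suc))
          (m≤n+m _ _)

-- The excess Q ∸ P has pair sum 0, hence vanishes off the diagonal.
sumPairs-tight : (P Q : Fin n → Fin n → ℕ) → (∀ i j → P i j ≡ P j i) → (∀ i j → Q i j ≡ Q j i) →
  (∀ i j → ¬ i ≡ j → P i j ≤ Q i j) → sumPairs Q ≤ sumPairs P → ∀ u v → ¬ u ≡ v → Q u v ≤ P u v
sumPairs-tight P Q P-sym Q-sym P≤Q ΣQ≤ΣP u v u≢v =
  m∸n≡0⇒m≤n (n≤0⇒n≡0 (≤-trans excess≤Σ (≤-reflexive Σexcess≡0)))
  where
  excess : Fin _ → Fin _ → ℕ
  excess i j = Q i j ∸ P i j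
  ΣQ≡ΣP+Σexcess : sumPairs Q ≡ sumPairs P + sumPairs excess
  ΣQ≡ΣP+Σexcess = trans (sumPairs-cong λ i j i≢j → sym (m+[n∸m]≡n (P≤Q i j i≢j))) (sumPairs-+ P excess)
  Σexcess≡0 : sumPairs excess ≡ 0
  Σexcess≡0 = n≤0⇒n≡0 (+-cancelˡ-≤ (sumPairs P) _ 0
    (≤-trans (≤-reflexive (sym ΣQ≡ΣP+Σexcess)) (≤-trans ΣQ≤ΣP (≤-reflexive (sym (+-identityʳ _))))))
  excess≤Σ : excess u v ≤ sumPairs excess
  excess≤Σ = ≤-sumPairs excess (λ i j → cong₂ _∸_ (Q-sym i j) (P-sym i j)) u v u≢v

sumPairs-square : (X : Fin n → Bool) → sumPairs (λ i j → χ (X i ∧ X j)) ≡ choose2 (count X)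
sumPairs-square {zero} X = refl
sumPairs-square {suc n} X with X zero
... | true = cong (count (X ∘ suc) +_) (sumPairs-square (X ∘ suc))
... | false = trans (cong (_+ sumPairs (λ i j → χ (X (suc i) ∧ X (suc j)))) (sum-replicate-zero n))
                    (sumPairs-square (X ∘ suc))

sum²≡sumPairs+sumPairs : (P : Fin n → Fin n → ℕ) → (∀ i j → P i j ≡ P j i) → (∀ i → P i i ≡ 0) →
  sum (λ i → sum (λ j → P i j)) ≡ sumPairs P + sumPairs P
sum²≡sumPairs+sumPairs {zero} P P-sym diag = refl
sum²≡sumPairs+sumPairs {suc n} P P-sym diag = begin
  (P zero zero + R) + sum (λ i → P (suc i) zero + sum (λ j → P′ i j))
    ≡⟨ cong₂ _+_ (cong (_+ R) (diag zero)) (∑-distrib-+ (λ i → P (suc i) zero) (λ i → sum (λ j → P′ i j))) ⟩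
  R + (sum (λ i → P (suc i) zero) + sum (λ i → sum (λ j → P′ i j)))
    ≡⟨ cong₂ (λ a b → R + (a + b)) (sum-cong-≗ λ i → P-sym (suc i) zero)
                                   (sum²≡sumPairs+sumPairs P′ (λ i j → P-sym (suc i) (suc j)) (diag ∘ suc)) ⟩
  R + (R + (sumPairs P′ + sumPairs P′))
    ≡⟨ regroup R (sumPairs P′) ⟩
  (R + sumPairs P′) + (R + sumPairs P′)
    ∎
  where
  open ≡-Reasoning
  R = sum (λ j → P zero (suc j))
  P′ : Fin n → Fin n → ℕ
  P′ i j = P (suc i) (suc j)
  regroup : ∀ a b → a + (a + (b + b)) ≡ (a + b) + (a + b)
  regroup = solve-∀

sum-ordered≡sumPairs : (P : Fin n → Fin n → Bool) →
  sum (λ i → sum (λ j → χ ((toℕ i <ᵇ toℕ j) ∧ P i j))) ≡ sumPairs (λ i j → χ (P i j))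
sum-ordered≡sumPairs {zero} P = refl
sum-ordered≡sumPairs {suc n} P =
  cong (sum (λ j → χ (P zero (suc j))) +_) (sum-ordered≡sumPairs (λ i j → P (suc i) (suc j)))

-- The potential

newEdges : ℕ → ℕ → ℕ
newEdges old new = choose2 new + old * new

-- The edge count of the extremal graphs on 1 + a K + s vertices (k = K + 1): a tree of a copies
-- of K_k, plus a further K_k sharing k - s vertices with it.
minEdges : ℕ → ℕ → ℕ → ℕ
minEdges K a s = a * choose2 (suc K) + newEdges (suc (K ∸ s)) s

-- Vertex counts are written 1 + a K + s with 1 ≤ s ≤ K.  Adding a clique with t new vertices
-- moves the potential from (a , s) to (a′ , s′), losing `slack` edges.
record CliqueStep (K a s t : ℕ) : Set where
  field
    a′ s′ slack : ℕ
    1≤s′ : 1 ≤ s′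
    s′≤K : s′ ≤ K
    size-eq : a′ * K + s′ ≡ a * K + s + t
    potential-eq : minEdges K a s + newEdges (suc (K ∸ t)) t ≡ minEdges K a′ s′ + slack
    from-full : s ≡ K → (a′ ≡ suc a) × (s′ ≡ t) × (slack ≡ 0)
    tight-from-partial : slack ≡ 0 → s < K → (t ≡ K) × (a′ ≡ suc a) × (s′ ≡ s)

private
  1≤m*n : ∀ {m n} → 1 ≤ m → 1 ≤ n → 1 ≤ m * n
  1≤m*n {suc m} {suc n} _ _ = s≤s z≤n

  -- The new vertices still fit into the current partial clique: K = s + t + z.
  cliqueStep-within : ∀ a s t z → 1 ≤ s → 1 ≤ t → CliqueStep (s + t + z) a s t
  cliqueStep-within a s t z 1≤s 1≤t = record
    { a′ = a ; s′ = s + t ; slack = s * t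
    ; 1≤s′ = ≤-trans 1≤s (m≤m+n s t)
    ; s′≤K = m≤m+n (s + t) z
    ; size-eq = sym (+-assoc (a * K′) s t)
    ; potential-eq = potential-eq
    ; from-full = λ s≡K → contradiction s≡K (<⇒≢ s<K)
    ; tight-from-partial = λ st≡0 _ → contradiction st≡0 (≢-sym (<⇒≢ (1≤m*n 1≤s 1≤t)))
    }
    where
    K′ = s + t + z
    s<K : s < K′
    s<K = ≤-trans (m<m+n s 1≤t) (m≤m+n (s + t) z)
    K∸s≡t+z : K′ ∸ s ≡ t + z
    K∸s≡t+z = trans (cong (_∸ s) (+-assoc s t z)) (m+n∸m≡n s (t + z))
    K∸t≡s+z : K′ ∸ t ≡ s + z
    K∸t≡s+z = trans (cong (λ w → w + z ∸ t) (+-comm s t)) (trans (cong (_∸ t) (+-assoc t s z)) (m+n∸m≡n t (s + z)))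
    potential-eq : minEdges K′ a s + newEdges (suc (K′ ∸ t)) t ≡ minEdges K′ a (s + t) + s * t
    potential-eq rewrite K∸s≡t+z | K∸t≡s+z | m+n∸m≡n (s + t) z | choose2-+ s t =
      ring (a * choose2 (suc K′)) s t z (choose2 s) (choose2 t)
      where
      ring : ∀ ac s t z cs ct → ac + (cs + suc (t + z) * s) + (ct + suc (s + z) * t)
                              ≡ ac + (cs + ct + s * t + suc z * (s + t)) + s * t
      ring = solve-∀

  -- The new vertices overflow the partial clique by d: K = x + y + d, s = y + d, t = x + d.
  cliqueStep-overflow : ∀ a x y d → 1 ≤ d → CliqueStep (x + y + d) a (y + d) (x + d)
  cliqueStep-overflow a x y d 1≤d = record
    { a′ = suc a ; s′ = d ; slack = x * y
    ; 1≤s′ = 1≤d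
    ; s′≤K = m≤n+m d (x + y)
    ; size-eq = ring-size a x y d
    ; potential-eq = potential-eq
    ; from-full = full
    ; tight-from-partial = tight
    }
    where
    K′ = x + y + d
    K∸s≡x : K′ ∸ (y + d) ≡ x
    K∸s≡x = trans (cong (_∸ (y + d)) (+-assoc x y d)) (m+n∸n≡m x (y + d))
    K∸t≡y : K′ ∸ (x + d) ≡ y
    K∸t≡y = trans (cong (λ w → w + d ∸ (x + d)) (+-comm x y))
                  (trans (cong (_∸ (x + d)) (+-assoc y x d)) (m+n∸n≡m y (x + d)))
    ring-size : ∀ a x y d → suc a * (x + y + d) + d ≡ a * (x + y + d) + (y + d) + (x + d)
    ring-size = solve-∀
    potential-eq : minEdges K′ a (y + d) + newEdges (suc (K′ ∸ (x + d))) (x + d) ≡ minEdges K′ (suc a) d + x * y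
    potential-eq rewrite K∸s≡x | K∸t≡y | m+n∸n≡m (x + y) d
                       | choose2-+ y d | choose2-+ x d | choose2-+ (x + y) d | choose2-+ x y =
      ring a x y d (choose2 x) (choose2 y) (choose2 d)
      where
      ring : ∀ a x y d cx cy cd →
        a * (x + y + d + (cx + cy + x * y + cd + (x + y) * d)) + (cy + cd + y * d + suc x * (y + d))
          + (cx + cd + x * d + suc y * (x + d))
        ≡ suc a * (x + y + d + (cx + cy + x * y + cd + (x + y) * d)) + (cd + suc (x + y) * d) + x * y
      ring = solve-∀
    full : y + d ≡ K′ → (suc a ≡ suc a) × (d ≡ x + d) × (x * y ≡ 0)
    full s≡K = refl , cong (_+ d) (sym x≡0) , cong (_* y) x≡0
      where
      x≡0 : x ≡ 0
      x≡0 = +-cancelʳ-≡ (y + d) x 0 (sym (trans s≡K (+-assoc x y d)))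
    tight : x * y ≡ 0 → y + d < K′ → (x + d ≡ K′) × (suc a ≡ suc a) × (d ≡ y + d)
    tight xy≡0 s<K with m*n≡0⇒m≡0∨n≡0 x xy≡0
    ... | inj₁ x≡0 = contradiction s<K (<-irrefl (sym (cong (λ w → w + y + d) x≡0)))
    ... | inj₂ y≡0 =
      trans (cong (_+ d) (sym (+-identityʳ x))) (cong (λ w → x + w + d) (sym y≡0)) , refl , cong (_+ d) (sym y≡0)

  overflow-split : ∀ {K s t} → s ≤ K → t ≤ K → K < s + t →
    Σ ℕ λ x → Σ ℕ λ y → Σ ℕ λ d → 1 ≤ d × s ≡ y + d × t ≡ x + d × K ≡ x + y + d
  overflow-split {K} {s} {t} s≤K t≤K K<s+t = x , y , d , m<n⇒0<n∸m K<s+t , s≡y+d , t≡x+d , K≡x+y+d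
    where
    x = K ∸ s
    y = K ∸ t
    d = s + t ∸ K
    s+x≡K : s + x ≡ K
    s+x≡K = m+[n∸m]≡n s≤K
    K+d≡s+t : K + d ≡ s + t
    K+d≡s+t = m+[n∸m]≡n (<⇒≤ K<s+t)
    s≡y+d : s ≡ y + d
    s≡y+d = +-cancelʳ-≡ t _ _ (trans (sym K+d≡s+t) (trans (cong (_+ d) (sym (m+[n∸m]≡n t≤K))) (shuffle t y d)))
      where shuffle : ∀ t y d → t + y + d ≡ y + d + t
            shuffle = solve-∀
    t≡x+d : t ≡ x + d
    t≡x+d = +-cancelˡ-≡ s _ _ (trans (sym K+d≡s+t) (trans (cong (_+ d) (sym s+x≡K)) (+-assoc s x d)))
    K≡x+y+d : K ≡ x + y + d
    K≡x+y+d = trans (sym s+x≡K) (trans (cong (_+ x) s≡y+d) (shuffle y d x))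
      where shuffle : ∀ y d x → y + d + x ≡ x + y + d
            shuffle = solve-∀

cliqueStep : ∀ K a s t → 1 ≤ s → s ≤ K → 1 ≤ t → t ≤ K → CliqueStep K a s t
cliqueStep K a s t 1≤s s≤K 1≤t t≤K with s + t ≤? K
... | yes s+t≤K with z , refl ← m≤n⇒∃[o]m+o≡n s+t≤K = cliqueStep-within a s t z 1≤s 1≤t
... | no s+t≰K with x , y , d , 1≤d , refl , refl , refl ← overflow-split s≤K t≤K (≰⇒> s+t≰K) =
  cliqueStep-overflow a x y d 1≤d

private
  overshoot : ∀ K a s s′ → 1 ≤ s′ → s ≤ K → s ≢ suc a * K + s′
  overshoot K a s s′ 1≤s′ s≤K s≡ = <⇒≱ K<s s≤K
    where
    K<s : K < s
    K<s = subst (K <_) (sym s≡) (≤-trans (m<m+n K 1≤s′) (+-monoˡ-≤ s′ (m≤m+n K (a * K))))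

  digits-quotient : ∀ K a s a′ s′ → 1 ≤ s → s ≤ K → 1 ≤ s′ → s′ ≤ K →
    a * K + s ≡ a′ * K + s′ → a ≡ a′
  digits-quotient K zero s zero s′ _ _ _ _ eq = refl
  digits-quotient K zero s (suc a′) s′ _ s≤K 1≤s′ _ eq = contradiction eq (overshoot K a′ s s′ 1≤s′ s≤K)
  digits-quotient K (suc a) s zero s′ 1≤s _ _ s′≤K eq = contradiction (sym eq) (overshoot K a s′ s 1≤s s′≤K)
  digits-quotient K (suc a) s (suc a′) s′ 1≤s s≤K 1≤s′ s′≤K eq =
    cong suc (digits-quotient K a s a′ s′ 1≤s s≤K 1≤s′ s′≤K
      (+-cancelˡ-≡ K _ _ (trans (sym (+-assoc K (a * K) s)) (trans eq (+-assoc K (a′ * K) s′)))))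

digits-unique : ∀ K a s a′ s′ → 1 ≤ s → s ≤ K → 1 ≤ s′ → s′ ≤ K →
  a * K + s ≡ a′ * K + s′ → a ≡ a′ × s ≡ s′
digits-unique K a s a′ s′ 1≤s s≤K 1≤s′ s′≤K eq
  with refl ← digits-quotient K a s a′ s′ 1≤s s≤K 1≤s′ s′≤K eq = refl , +-cancelˡ-≡ (a * K) _ _ eq

choose2-split : ∀ K r → r ≤ K → choose2 (suc K) ≡ choose2 (suc (K ∸ r)) + newEdges (suc (K ∸ r)) r
choose2-split K r r≤K = begin
  choose2 (suc K)                     ≡⟨ cong (choose2 ∘′ suc) (m∸n+n≡m r≤K) ⟨
  choose2 (kept + r)                     ≡⟨ choose2-+ kept r ⟩
  choose2 kept + choose2 r + kept * r       ≡⟨ +-assoc (choose2 kept) (choose2 r) (kept * r) ⟩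
  choose2 kept + newEdges kept r            ∎
  where
  open ≡-Reasoning
  kept = suc (K ∸ r)

minEdges≡bound : ∀ K q r → r ≤ K → (q + 2) * (suc K C 2) ∸ ((suc K ∸ r) C 2) ≡ minEdges K (suc q) r
minEdges≡bound K q r r≤K = begin
  (q + 2) * (suc K C 2) ∸ ((suc K ∸ r) C 2)
    ≡⟨ cong₂ (λ u v → (q + 2) * u ∸ v) (sym (choose2≡C2 (suc K)))
                                      (trans (sym (choose2≡C2 (suc K ∸ r))) (cong choose2 (+-∸-assoc 1 r≤K))) ⟩
  (q + 2) * choose2 (suc K) ∸ choose2 kept
    ≡⟨ cong (λ w → (q + 2) * w ∸ choose2 kept) (choose2-split K r r≤K) ⟩
  (q + 2) * (choose2 kept + newEdges kept r) ∸ choose2 kept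
    ≡⟨ cong (_∸ choose2 kept) (ring q (choose2 kept) (newEdges kept r)) ⟩
  suc q * (choose2 kept + newEdges kept r) + newEdges kept r + choose2 kept ∸ choose2 kept
    ≡⟨ m+n∸n≡m _ (choose2 kept) ⟩
  suc q * (choose2 kept + newEdges kept r) + newEdges kept r
    ≡⟨ cong (λ w → suc q * w + newEdges kept r) (choose2-split K r r≤K) ⟨
  minEdges K (suc q) r
    ∎
  where
  open ≡-Reasoning
  kept = suc (K ∸ r)
  ring : ∀ q a b → (q + 2) * (a + b) ≡ suc q * (a + b) + b + a
  ring = solve-∀

-- Growing a vertex set by cliques

∧-swap : ∀ a b c → a ∧ b ∧ c ≡ b ∧ a ∧ c
∧-swap true b c = refl
∧-swap false b c rewrite ∧-zeroʳ b = refl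

-- Pairs of a clique C (first two arguments) split into those inside S (last two) and the others.
χ-pair-split : ∀ a b c d → χ (a ∧ b) ≡ χ (a ∧ b ∧ not (c ∧ d)) + χ ((a ∧ c) ∧ (b ∧ d))
χ-pair-split true true c d with c ∧ d
... | true = refl
... | false = refl
χ-pair-split true false c d rewrite ∧-zeroʳ c = refl
χ-pair-split false b c d = refl

-- An adjacent pair inside S ∪ C is counted at most once: as a pair of S, or as a pair of C not inside S.
χ-pair-grow : ∀ si sj ci cj e → (ci ∧ cj ≡ true → e ≡ true) →
  χ (si ∧ sj ∧ e) + χ (ci ∧ cj ∧ not (si ∧ sj)) ≤ χ ((si ∨ ci) ∧ (sj ∨ cj) ∧ e)
χ-pair-grow true  true  ci    cj    e h rewrite ∧-zeroʳ cj | ∧-zeroʳ ci = ≤-reflexive (+-identityʳ (χ e))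
χ-pair-grow true  false true  true  e h rewrite h refl = ≤-refl
χ-pair-grow false true  true  true  e h rewrite h refl = ≤-refl
χ-pair-grow false false true  true  e h rewrite h refl = ≤-refl
χ-pair-grow true  false true  false e h = z≤n
χ-pair-grow true  false false cj    e h = z≤n
χ-pair-grow false _     true  false e h = z≤n
χ-pair-grow false _     false cj    e h = z≤n

edgeCount≡sumPairs : ∀ {m} (H : Graph m) → edgeCount H ≡ sumPairs (λ a b → χ (adj H a b))
edgeCount≡sumPairs {m} H = begin
  edgeCount H
    ≡⟨ sum-allFin (λ i → ListAction.sum (map (term i) (allFin m))) ⟩
  sum (λ i → ListAction.sum (map (term i) (allFin m)))
    ≡⟨ sum-cong-≗ {m} (λ i → sum-allFin (term i)) ⟩
  sum (λ i → sum (term i))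
    ≡⟨ sum-cong-≗ {m} (λ i → sum-cong-≗ {m} (χ-if ∘ counted i)) ⟩
  sum (λ i → sum (λ j → χ (counted i j)))
    ≡⟨ sum-ordered≡sumPairs (adj H) ⟩
  sumPairs (λ a b → χ (adj H a b))
    ∎
  where
  open ≡-Reasoning
  counted : Fin m → Fin m → Bool
  counted i j = (toℕ i <ᵇ toℕ j) ∧ adj H i j
  term : Fin m → Fin m → ℕ
  term i j = if counted i j then 1 else 0

module Cliques {n : ℕ} (G : Graph n) where

  edgesIn : (Fin n → Bool) → ℕ
  edgesIn S = sumPairs (λ i j → χ (S i ∧ S j ∧ adj G i j))

  edgesIn-symmetric : ∀ (S : Fin n → Bool) i j → χ (S i ∧ S j ∧ adj G i j) ≡ χ (S j ∧ S i ∧ adj G j i)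
  edgesIn-symmetric S i j =
    cong χ (trans (∧-swap (S i) (S j) (adj G i j)) (cong (λ e → S j ∧ S i ∧ e) (adj-sym G i j)))

  edgesIn-all : (S : Fin n → Bool) → (∀ x → S x ≡ true) → edgesIn S ≡ edgeCount G
  edgesIn-all S all =
    trans (sumPairs-cong λ i j _ → cong₂ (λ a b → χ (a ∧ b ∧ adj G i j)) (all i) (all j))
          (sym (edgeCount≡sumPairs G))

  record Clique (k : ℕ) : Set where
    field
      vertex : Fin k → Fin n
      injective : Injective _≡_ _≡_ vertex
      adjacent : ∀ a b → ¬ a ≡ b → adj G (vertex a) (vertex b) ≡ true
  open Clique public

  members : ∀ {k} → Clique k → Fin n → Bool
  members cl x = does (any? λ a → vertex cl a ≟ x)

  members-intro : ∀ {k} (cl : Clique k) a → members cl (vertex cl a) ≡ true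
  members-intro cl a = dec-true (any? λ b → vertex cl b ≟ vertex cl a) (a , refl)

  members-elim : ∀ {k} (cl : Clique k) x → members cl x ≡ true → ∃ λ a → vertex cl a ≡ x
  members-elim cl x = from-does (any? λ a → vertex cl a ≟ x)

  count-members : ∀ {k} (cl : Clique k) → count (members cl) ≡ k
  count-members cl = count-image (vertex cl) (injective cl) (members cl) (members-elim cl) (members-intro cl)

  members-adjacent : ∀ {k} (cl : Clique k) x y → members cl x ≡ true → members cl y ≡ true → ¬ x ≡ y →
    adj G x y ≡ true
  members-adjacent cl x y Cx Cy x≢y with members-elim cl x Cx | members-elim cl y Cy
  ... | a , refl | b , refl = adjacent cl a b (x≢y ∘ cong (vertex cl))

  edgesIn-members : ∀ {k} (cl : Clique k) → edgesIn (members cl) ≡ choose2 k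
  edgesIn-members cl =
    trans (sumPairs-cong pointwise) (trans (sumPairs-square (members cl)) (cong choose2 (count-members cl)))
    where
    pointwise : ∀ i j → ¬ i ≡ j → χ (members cl i ∧ members cl j ∧ adj G i j) ≡ χ (members cl i ∧ members cl j)
    pointwise i j i≢j with members cl i in Ci | members cl j in Cj
    ... | true | true rewrite members-adjacent cl i j Ci Cj i≢j = refl
    ... | true | false = refl
    ... | false | _ = refl

  record FormsL {k} (H J : Clique k) (s : ℕ) : Set where
    field
      shared : ℕ
      shared+s≡k : shared + s ≡ k
      count-shared : count (λ x → members H x ∧ members J x) ≡ shared
      count-J-only : count (λ x → members J x ∧ not (members H x)) ≡ s
      count-H-only : count (λ x → members H x ∧ not (members J x)) ≡ s
      no-cross-edges : ∀ x y → members H x ≡ true → members J x ≡ false →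
        members J y ≡ true → members H y ≡ false → adj G x y ≡ false


module Growth (K : ℕ) {n : ℕ} (G : Graph n) (connected : Connected G) (cover : HasK1Cover (suc K) G) where

  open Cliques G public

  leaving-edge : (S : Fin n → Bool) {y x : Fin n} → Walk G y x → S y ≡ true → S x ≡ false →
    Σ (Fin n) λ u → Σ (Fin n) λ v → S u ≡ true × S v ≡ false × adj G u v ≡ true
  leaving-edge S here Sy Sx = contradiction (trans (sym Sy) Sx) λ ()
  leaving-edge S (step {w = w} uw rest) Su Sx with S w in Sw
  ... | true = leaving-edge S rest Sw Sx
  ... | false = _ , w , Su , Sw , uw

  record Extension (S : Fin n → Bool) : Set where
    field
      clique : Clique (suc K)
      old new : ℕ
      count-old : count (λ x → members clique x ∧ S x) ≡ old
      count-new : count (λ x → members clique x ∧ not (S x)) ≡ new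
      old+new≡k : old + new ≡ suc K
      1≤old : 1 ≤ old
      1≤new : 1 ≤ new

  extend : (S : Fin n → Bool) {y x : Fin n} → S y ≡ true → S x ≡ false → Extension S
  extend S {y} {x} Sy Sx with leaving-edge S (connected y x) Sy Sx
  ... | u , v , Su , Sv , uv with cover u v uv
  ... | f , (f-inj , f-adj) , (a , fa≡u) , (b , fb≡v) = record
    { clique = cl ; old = _ ; new = _ ; count-old = refl ; count-new = refl
    ; old+new≡k = trans (sym (count-split (members cl) S)) (count-members cl)
    ; 1≤old = count-pos _ u (cong₂ _∧_ (member fa≡u) Su)
    ; 1≤new = count-pos _ v (cong₂ _∧_ (member fb≡v) (cong not Sv))
    }
    where
    cl : Clique (suc K)
    cl = record { vertex = f ; injective = f-inj ; adjacent = f-adj }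
    member : ∀ {a z} → f a ≡ z → members cl z ≡ true
    member {a} refl = members-intro cl a

  module Grown {S : Fin n → Bool} (ext : Extension S) where

    open Extension ext

    grown : Fin n → Bool
    grown x = S x ∨ members clique x

    count-grown : count grown ≡ count S + new
    count-grown = trans (count-∨ S (members clique)) (cong (count S +_) count-new)

    new≤K : new ≤ K
    new≤K = ≤-pred (≤-trans (+-monoˡ-≤ new 1≤old) (≤-reflexive old+new≡k))

    old≡k∸new : old ≡ suc (K ∸ new)
    old≡k∸new = +-cancelʳ-≡ new _ _ (trans old+new≡k (cong suc (sym (m∸n+n≡m new≤K))))

    oldPairs newPairs : Fin n → Fin n → ℕ
    oldPairs i j = χ (S i ∧ S j ∧ adj G i j)
    newPairs i j = χ (members clique i ∧ members clique j ∧ not (S i ∧ S j))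

    sumPairs-newPairs : sumPairs newPairs ≡ newEdges old new
    sumPairs-newPairs = +-cancelʳ-≡ (choose2 old) _ _ (begin
      sumPairs newPairs + choose2 old                     ≡⟨ cong (λ m → sumPairs newPairs + choose2 m) count-old ⟨
      sumPairs newPairs + choose2 (count C∩S)             ≡⟨ cong (sumPairs newPairs +_) (sumPairs-square C∩S) ⟨
      sumPairs newPairs + sumPairs (λ i j → χ (C∩S i ∧ C∩S j))
                                                          ≡⟨ sumPairs-+ newPairs _ ⟨
      sumPairs (λ i j → newPairs i j + χ (C∩S i ∧ C∩S j))
                                                          ≡⟨ sumPairs-cong (λ i j _ → sym (χ-pair-split (C i) (C j) (S i) (S j))) ⟩
      sumPairs (λ i j → χ (C i ∧ C j))                    ≡⟨ sumPairs-square C ⟩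
      choose2 (count C)                                   ≡⟨ cong choose2 (trans (count-members clique) (sym old+new≡k)) ⟩
      choose2 (old + new)                                 ≡⟨ choose2-+ old new ⟩
      choose2 old + choose2 new + old * new               ≡⟨ rotate (choose2 old) (choose2 new) (old * new) ⟩
      newEdges old new + choose2 old                      ∎)
      where
      open ≡-Reasoning
      C C∩S : Fin n → Bool
      C = members clique
      C∩S x = C x ∧ S x
      rotate : ∀ a b c → a + b + c ≡ b + c + a
      rotate a b c = trans (+-assoc a b c) (+-comm a (b + c))

    grown-dominates : ∀ i j → ¬ i ≡ j → oldPairs i j + newPairs i j ≤ χ (grown i ∧ grown j ∧ adj G i j)
    grown-dominates i j i≢j = χ-pair-grow (S i) (S j) (members clique i) (members clique j) (adj G i j)
      λ CiCj → members-adjacent clique i j (∧-conicalˡ _ _ CiCj) (∧-conicalʳ _ _ CiCj) i≢j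

    counted-pairs : edgesIn S + newEdges old new ≡ sumPairs (λ i j → oldPairs i j + newPairs i j)
    counted-pairs = trans (cong (edgesIn S +_) (sym sumPairs-newPairs)) (sym (sumPairs-+ oldPairs newPairs))

    edgesIn-grown : edgesIn S + newEdges old new ≤ edgesIn grown
    edgesIn-grown = ≤-trans (≤-reflexive counted-pairs) (sumPairs-mono-≤ grown-dominates)

    tight-grown : edgesIn grown ≤ edgesIn S + newEdges old new → ∀ x y → ¬ x ≡ y → adj G x y ≡ true →
      grown x ≡ true → grown y ≡ true → S y ≡ false → members clique x ≡ true
    tight-grown tight x y x≢y xy gx gy Sy =
      ¬-not λ Cx → contradiction (subst₂ _≤_ counted (uncounted Cx) dominated) λ ()
      where
      C : Fin n → Bool
      C = members clique
      symmetric : ∀ i j → oldPairs i j + newPairs i j ≡ oldPairs j i + newPairs j i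
      symmetric i j = cong₂ _+_ (edgesIn-symmetric S i j)
        (cong χ (trans (∧-swap (C i) (C j) (not (S i ∧ S j))) (cong (λ b → C j ∧ C i ∧ not b) (∧-comm (S i) (S j)))))
      dominated : χ (grown x ∧ grown y ∧ adj G x y) ≤ oldPairs x y + newPairs x y
      dominated = sumPairs-tight _ _ symmetric (edgesIn-symmetric grown) grown-dominates
                                 (≤-trans tight (≤-reflexive counted-pairs)) x y x≢y
      counted : χ (grown x ∧ grown y ∧ adj G x y) ≡ 1
      counted = cong χ (trans (cong₂ (λ a b → a ∧ b ∧ adj G x y) gx gy) xy)
      uncounted : C x ≡ false → oldPairs x y + newPairs x y ≡ 0
      uncounted Cx rewrite Sy | Cx | ∧-zeroʳ (S x) = refl

-- The lower bound

-- Read e and e′ as the edges inside S before and after a step gaining at least F edges, E as e(G),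
-- A and A′ as the potentials before and after the step, and Vf as the final potential.
potential-bound-step : ∀ e e′ E F A A′ slack Vf → e + F ≤ e′ → e′ + Vf ≤ E + A′ → A + F ≡ A′ + slack →
  e + Vf ≤ E + A
potential-bound-step e e′ E F A A′ slack Vf gain ih pot = +-cancelʳ-≤ F (e + Vf) (E + A) (begin
  e + Vf + F       ≡⟨ swap e Vf F ⟩
  e + F + Vf       ≤⟨ +-monoˡ-≤ Vf gain ⟩
  e′ + Vf          ≤⟨ ih ⟩
  E + A′           ≤⟨ m≤m+n (E + A′) slack ⟩
  E + A′ + slack   ≡⟨ +-assoc E A′ slack ⟩
  E + (A′ + slack) ≡⟨ cong (E +_) pot ⟨
  E + (A + F)      ≡⟨ +-assoc E A F ⟨
  E + A + F        ∎)
  where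
  open ≤-Reasoning
  swap : ∀ a b c → a + b + c ≡ a + c + b
  swap = solve-∀

potential-tight-step : ∀ e e′ E F A A′ slack Vf → e + F ≤ e′ → e′ + Vf ≤ E + A′ → A + F ≡ A′ + slack →
  E + A ≤ e + Vf → (slack ≡ 0) × (e′ ≤ e + F) × (E + A′ ≤ e′ + Vf)
potential-tight-step e e′ E F A A′ slack Vf gain ih pot tight = slack≡0 , e′≤e+F , E+A′≤e′+Vf
  where
  open ≤-Reasoning
  swap : ∀ a b c → a + b + c ≡ a + c + b
  swap = solve-∀
  rearranged : E + A′ + slack ≡ E + A + F
  rearranged = trans (+-assoc E A′ slack) (trans (cong (E +_) (sym pot)) (sym (+-assoc E A F)))
  E+A+F≤e′+Vf : E + A + F ≤ e′ + Vf
  E+A+F≤e′+Vf = begin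
    E + A + F   ≤⟨ +-monoˡ-≤ F tight ⟩
    e + Vf + F  ≡⟨ swap e Vf F ⟩
    e + F + Vf  ≤⟨ +-monoˡ-≤ Vf gain ⟩
    e′ + Vf     ∎
  slack≡0 : slack ≡ 0
  slack≡0 = n≤0⇒n≡0 (+-cancelˡ-≤ (E + A′) slack 0 (begin
    E + A′ + slack  ≡⟨ rearranged ⟩
    E + A + F       ≤⟨ E+A+F≤e′+Vf ⟩
    e′ + Vf         ≤⟨ ih ⟩
    E + A′          ≡⟨ +-identityʳ (E + A′) ⟨
    E + A′ + 0      ∎))
  e′≤e+F : e′ ≤ e + F
  e′≤e+F = +-cancelʳ-≤ Vf e′ (e + F) (begin
    e′ + Vf         ≤⟨ ih ⟩
    E + A′          ≤⟨ m≤m+n (E + A′) slack ⟩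
    E + A′ + slack  ≡⟨ rearranged ⟩
    E + A + F       ≤⟨ +-monoˡ-≤ F tight ⟩
    e + Vf + F      ≡⟨ swap e Vf F ⟩
    e + F + Vf      ∎)
  E+A′≤e′+Vf : E + A′ ≤ e′ + Vf
  E+A′≤e′+Vf = ≤-trans (m≤m+n (E + A′) slack) (≤-trans (≤-reflexive rearranged) E+A+F≤e′+Vf)

module LowerBound (K : ℕ) {n : ℕ} (G : Graph n) (connected : Connected G) (cover : HasK1Cover (suc K) G)
                  (a∞ s∞ : ℕ) (n≡ : n ≡ suc (a∞ * K + s∞)) (1≤s∞ : 1 ≤ s∞) (s∞≤K : s∞ ≤ K) where

  open Growth K G connected cover public

  target : ℕ
  target = minEdges K a∞ s∞

  record Shape (S : Fin n → Bool) (a s : ℕ) : Set where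
    field
      has-size : count S ≡ suc (a * K + s)
      1≤s : 1 ≤ s
      s≤K : s ≤ K

  Tight : (Fin n → Bool) → ℕ → ℕ → Set
  Tight S a s = edgeCount G + minEdges K a s ≤ edgesIn S + target

  shape-full : ∀ {S a s} → Shape S a s → (∀ x → S x ≡ true) → (a ≡ a∞) × (s ≡ s∞)
  shape-full {S} shape full = digits-unique K _ _ a∞ s∞ (Shape.1≤s shape) (Shape.s≤K shape) 1≤s∞ s∞≤K
    (suc-injective (trans (sym (Shape.has-size shape)) (trans (count-all S full) n≡)))

  module Advance {S : Fin n → Bool} {a s : ℕ} (shape : Shape S a s) {x : Fin n} (Sx : S x ≡ false) where

    open Shape shape

    ext : Extension S
    ext = extend S (proj₂ inside) Sx
      where
      inside : ∃ λ y → S y ≡ true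
      inside = count-nonempty S (subst (1 ≤_) (sym has-size) (s≤s z≤n))

    open Extension ext public
    open Grown ext public
    open CliqueStep (cliqueStep K a s new 1≤s s≤K 1≤new new≤K) public

    shape′ : Shape grown a′ s′
    shape′ = record
      { has-size = trans count-grown (trans (cong (_+ new) has-size) (cong suc (sym size-eq)))
      ; 1≤s = 1≤s′ ; s≤K = s′≤K }

    potential-eq′ : minEdges K a s + newEdges old new ≡ minEdges K a′ s′ + slack
    potential-eq′ = trans (cong (λ m → minEdges K a s + newEdges m new) old≡k∸new) potential-eq

    fuel-step : ∀ fuel → n ≤ count S + suc fuel → n ≤ count grown + fuel
    fuel-step fuel enough = begin
      n                      ≤⟨ enough ⟩
      count S + suc fuel     ≡⟨ +-assoc (count S) 1 fuel ⟨
      count S + 1 + fuel     ≤⟨ +-monoˡ-≤ fuel (+-monoʳ-≤ (count S) 1≤new) ⟩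
      count S + new + fuel   ≡⟨ cong (_+ fuel) count-grown ⟨
      count grown + fuel     ∎
      where open ≤-Reasoning

  out-of-fuel : ∀ {S : Fin n → Bool} {x} → S x ≡ false → ¬ (n ≤ count S + 0)
  out-of-fuel {S} {x} Sx enough = <⇒≱ (count<n S x Sx) (subst (n ≤_) (+-identityʳ (count S)) enough)

  lower-bound : ∀ fuel {S a s} → Shape S a s → n ≤ count S + fuel →
    edgesIn S + target ≤ edgeCount G + minEdges K a s
  lower-bound fuel {S} shape enough with full-or-missing S
  ... | inj₁ full with shape-full shape full
  ...   | refl , refl = ≤-reflexive (cong (_+ target) (edgesIn-all S full))
  lower-bound zero shape enough | inj₂ (x , Sx) = contradiction enough (out-of-fuel Sx)
  lower-bound (suc fuel) {S} {a} {s} shape enough | inj₂ (x , Sx) =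
    potential-bound-step (edgesIn S) (edgesIn grown) (edgeCount G) (newEdges old new)
                         (minEdges K a s) (minEdges K a′ s′) slack target
                         edgesIn-grown (lower-bound fuel shape′ (fuel-step fuel enough)) potential-eq′
    where open Advance shape Sx

  record TightAdvance {S a s} (shape : Shape S a s) {x} (Sx : S x ≡ false) : Set where
    open Advance shape Sx
    field
      no-slack : slack ≡ 0
      tight-ext : edgesIn grown ≤ edgesIn S + newEdges old new
      tight′ : Tight grown a′ s′

  tight-advance : ∀ fuel {S a s} (shape : Shape S a s) {x} (Sx : S x ≡ false) → n ≤ count S + suc fuel →
    Tight S a s → TightAdvance shape Sx
  tight-advance fuel {S} {a} {s} shape Sx enough tight =
    record-of (potential-tight-step (edgesIn S) (edgesIn grown) (edgeCount G) (newEdges old new)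
                                    (minEdges K a s) (minEdges K a′ s′) slack target
                                    edgesIn-grown (lower-bound fuel shape′ (fuel-step fuel enough)) potential-eq′ tight)
    where
    open Advance shape Sx
    record-of : (slack ≡ 0) × (edgesIn grown ≤ edgesIn S + newEdges old new) × Tight grown a′ s′ →
      TightAdvance shape Sx
    record-of (no-slack , tight-ext , tight′) = record { no-slack = no-slack ; tight-ext = tight-ext ; tight′ = tight′ }

-- Block trees and the equality case

∨-introˡ : ∀ {a} b → a ≡ true → a ∨ b ≡ true
∨-introˡ b refl = refl

∨-introʳ : ∀ a {b} → b ≡ true → a ∨ b ≡ true
∨-introʳ a refl = ∨-zeroʳ a

∨-elim : ∀ a {b} → a ∨ b ≡ true → a ≡ true ⊎ b ≡ true
∨-elim true _ = inj₁ refl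
∨-elim false b≡true = inj₂ b≡true

squeeze-∧ : ∀ b c s → (b ≡ true → s ≡ true) → (c ∧ s ≡ true → b ≡ true) → b ∧ c ≡ c ∧ s
squeeze-∧ true  true  s b⇒s _ = sym (b⇒s refl)
squeeze-∧ true  false s _ _ = refl
squeeze-∧ false true  true _ cs⇒b = cs⇒b refl
squeeze-∧ false true  false _ _ = refl
squeeze-∧ false false s _ _ = refl

squeeze-∧-not : ∀ b c s → (b ≡ true → s ≡ true) → (c ∧ s ≡ true → b ≡ true) → c ∧ not b ≡ c ∧ not s
squeeze-∧-not true  true  s b⇒s _ rewrite b⇒s refl = refl
squeeze-∧-not true  false s _ _ = refl
squeeze-∧-not false true  true _ cs⇒b with cs⇒b refl
... | ()
squeeze-∧-not false true  false _ _ = refl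
squeeze-∧-not false false s _ _ = refl

module BlockTrees {n : ℕ} (G : Graph n) where

  IsClique : (Fin n → Bool) → Set
  IsClique Q = ∀ x y → Q x ≡ true → Q y ≡ true → ¬ x ≡ y → adj G x y ≡ true

  InOlder : ∀ {b} → (Fin b → Fin n → Bool) → Fin b → Fin n → Set
  InOlder E i x = ∃ λ j → toℕ i < toℕ j × E j x ≡ true

  -- Blocks are listed newest first: each block meets the union of the older ones in at most one vertex.
  record BlockTree (b : ℕ) (E : Fin b → Fin n → Bool) (S : Fin n → Bool) : Set where
    field
      covered : ∀ x → S x ≡ true → ∃ λ i → E i x ≡ true
      within : ∀ i x → E i x ≡ true → S x ≡ true
      clique-in-block : ∀ Q → (∀ x → Q x ≡ true → S x ≡ true) → IsClique Q →
        ∃ λ i → ∀ x → Q x ≡ true → E i x ≡ true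
      attached-once : ∀ i x y → E i x ≡ true → E i y ≡ true → InOlder E i x → InOlder E i y → x ≡ y

  blockTree-cong : ∀ {b E E′ S S′} → BlockTree b E S → (∀ i x → E i x ≡ E′ i x) → (∀ x → S x ≡ S′ x) →
    BlockTree b E′ S′
  blockTree-cong T E≡E′ S≡S′ = record
    { covered = λ x S′x → let (i , Eix) = covered x (trans (S≡S′ x) S′x) in i , trans (sym (E≡E′ i x)) Eix
    ; within = λ i x E′ix → trans (sym (S≡S′ x)) (within i x (trans (E≡E′ i x) E′ix))
    ; clique-in-block = λ Q Q⊆S′ Q-clique →
        let (i , Q⊆Ei) = clique-in-block Q (λ x Qx → trans (S≡S′ x) (Q⊆S′ x Qx)) Q-clique in
        i , λ x Qx → trans (sym (E≡E′ i x)) (Q⊆Ei x Qx)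
    ; attached-once = λ i x y Eix Eiy (j , i<j , Ejx) (j′ , i<j′ , Ej′y) →
        attached-once i x y (trans (E≡E′ i x) Eix) (trans (E≡E′ i y) Eiy)
          (j , i<j , trans (E≡E′ j x) Ejx) (j′ , i<j′ , trans (E≡E′ j′ y) Ej′y)
    }
    where open BlockTree T

  single-block : (S : Fin n → Bool) → BlockTree 1 (λ _ → S) S
  single-block S = record
    { covered = λ x Sx → zero , Sx
    ; within = λ i x Sx → Sx
    ; clique-in-block = λ Q Q⊆S _ → zero , Q⊆S
    ; attached-once = λ { zero x y _ _ (zero , () , _) _ }
    }

module Extremal (K : ℕ) {n : ℕ} (G : Graph n) (connected : Connected G) (cover : HasK1Cover (suc K) G)
                (a∞ s∞ : ℕ) (n≡ : n ≡ suc (a∞ * K + s∞)) (1≤s∞ : 1 ≤ s∞) (s∞≤K : s∞ ≤ K) where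

  open LowerBound K G connected cover a∞ s∞ n≡ 1≤s∞ s∞≤K public
  open BlockTrees G public

  module TightExtension {S : Fin n → Bool} (ext : Extension S)
    (tight : edgesIn (Grown.grown ext) ≤ edgesIn S + newEdges (Extension.old ext) (Extension.new ext)) where

    open Extension ext
    open Grown ext

    clique-through-new : ∀ Q → (∀ x → Q x ≡ true → grown x ≡ true) → IsClique Q →
      ∀ {y} → Q y ≡ true → S y ≡ false → ∀ x → Q x ≡ true → members clique x ≡ true
    clique-through-new Q Q⊆grown Q-clique {y} Qy Sy x Qx with x ≟ y
    ... | yes refl with ∨-elim (S x) (Q⊆grown x Qx)
    ...   | inj₁ Sx = contradiction (trans (sym Sx) Sy) λ ()
    ...   | inj₂ Cx = Cx
    clique-through-new Q Q⊆grown Q-clique {y} Qy Sy x Qx | no x≢y =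
      tight-grown tight x y x≢y (Q-clique x y Qx Qy x≢y) (Q⊆grown x Qx) (Q⊆grown y Qy) Sy

    clique-old-or-new : ∀ Q → (∀ x → Q x ≡ true → grown x ≡ true) → IsClique Q →
      (∀ x → Q x ≡ true → S x ≡ true) ⊎ (∀ x → Q x ≡ true → members clique x ≡ true)
    clique-old-or-new Q Q⊆grown Q-clique with any? (λ x → (Q x Bool.≟ true) ×-dec (S x Bool.≟ false))
    ... | yes (y , Qy , Sy) = inj₂ (clique-through-new Q Q⊆grown Q-clique Qy Sy)
    ... | no none = inj₁ λ x Qx → ¬-not λ Sx → none (x , Qx , Sx)

    grown-old : ∀ x → S x ≡ true → grown x ≡ true
    grown-old x = ∨-introˡ (members clique x)

    grown-new : ∀ x → members clique x ≡ true → grown x ≡ true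
    grown-new x = ∨-introʳ (S x)

    add-block : ∀ {b E} → BlockTree b E S → old ≡ 1 → BlockTree (suc b) (members clique ∷ᶠ E) grown
    add-block {b} {E} T old≡1 = record
      { covered = covered′
      ; within = within′
      ; clique-in-block = clique-in-block′
      ; attached-once = attached-once′
      }
      where
      open BlockTree T
      covered′ : ∀ x → grown x ≡ true → ∃ λ i → (members clique ∷ᶠ E) i x ≡ true
      covered′ x gx with ∨-elim (S x) gx
      ... | inj₁ Sx = let (i , Eix) = covered x Sx in suc i , Eix
      ... | inj₂ Cx = zero , Cx
      within′ : ∀ i x → (members clique ∷ᶠ E) i x ≡ true → grown x ≡ true
      within′ zero x Cx = grown-new x Cx
      within′ (suc i) x Eix = grown-old x (within i x Eix)
      clique-in-block′ : ∀ Q → (∀ x → Q x ≡ true → grown x ≡ true) → IsClique Q →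
        ∃ λ i → ∀ x → Q x ≡ true → (members clique ∷ᶠ E) i x ≡ true
      clique-in-block′ Q Q⊆grown Q-clique with clique-old-or-new Q Q⊆grown Q-clique
      ... | inj₁ Q⊆S = let (i , Q⊆Ei) = clique-in-block Q Q⊆S Q-clique in suc i , Q⊆Ei
      ... | inj₂ Q⊆C = zero , Q⊆C
      old-vertex : ∀ x → members clique x ≡ true → InOlder (members clique ∷ᶠ E) zero x →
        members clique x ∧ S x ≡ true
      old-vertex x Cx (suc j , _ , Ejx) = cong₂ _∧_ Cx (within j x Ejx)
      attached-once′ : ∀ i x y → (members clique ∷ᶠ E) i x ≡ true → (members clique ∷ᶠ E) i y ≡ true →
        InOlder (members clique ∷ᶠ E) i x → InOlder (members clique ∷ᶠ E) i y → x ≡ y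
      attached-once′ zero x y Cx Cy older-x older-y =
        count≤1⇒unique _ (≤-reflexive (trans count-old old≡1)) x y
          (old-vertex x Cx older-x) (old-vertex y Cy older-y)
      attached-once′ (suc i) x y Eix Eiy (zero , () , _) _
      attached-once′ (suc i) x y Eix Eiy (suc j , _ , _) (zero , () , _)
      attached-once′ (suc i) x y Eix Eiy (suc j , i<j , Ejx) (suc j′ , i<j′ , Ej′y) =
        attached-once i x y Eix Eiy (j , ≤-pred i<j , Ejx) (j′ , ≤-pred i<j′ , Ej′y)

    mergeAt : ∀ {b} → (Fin b → Fin n → Bool) → Fin b → Fin b → Fin n → Bool
    mergeAt E p i x = E i x ∨ (does (i ≟ p) ∧ members clique x)

    -- A vertex of two merged blocks already lies in both original blocks, as C ∩ S ⊆ E p.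
    merged-shared-is-old : ∀ {b E} → BlockTree b E S → (p : Fin b) →
      (∀ x → members clique x ∧ S x ≡ true → E p x ≡ true) →
      ∀ i j x → ¬ i ≡ j → mergeAt E p i x ≡ true → mergeAt E p j x ≡ true → E i x ≡ true
    merged-shared-is-old {E = E} T p C∩S⊆Ep i j x i≢j E′ix E′jx with ∨-elim (E i x) E′ix
    ... | inj₁ Eix = Eix
    ... | inj₂ pCx with from-does (i ≟ p) (∧-conicalˡ _ _ pCx)
    ...   | refl with ∨-elim (E j x) E′jx
    ...     | inj₁ Ejx = C∩S⊆Ep x (cong₂ _∧_ (∧-conicalʳ _ _ pCx) (BlockTree.within T j x Ejx))
    ...     | inj₂ jCx = contradiction (sym (from-does (j ≟ i) (∧-conicalˡ _ _ jCx))) i≢j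

    merge-block : ∀ {b E} → BlockTree b E S → (p : Fin b) →
      (∀ x → members clique x ∧ S x ≡ true → E p x ≡ true) → BlockTree b (mergeAt E p) grown
    merge-block {b} {E} T p C∩S⊆Ep = record
      { covered = covered′
      ; within = within′
      ; clique-in-block = clique-in-block′
      ; attached-once = attached-once′
      }
      where
      open BlockTree T
      E⊆E′ : ∀ i x → E i x ≡ true → mergeAt E p i x ≡ true
      E⊆E′ i x = ∨-introˡ (does (i ≟ p) ∧ members clique x)
      C⊆E′p : ∀ x → members clique x ≡ true → mergeAt E p p x ≡ true
      C⊆E′p x Cx = ∨-introʳ (E p x) (cong₂ _∧_ (dec-true (p ≟ p) refl) Cx)
      covered′ : ∀ x → grown x ≡ true → ∃ λ i → mergeAt E p i x ≡ true
      covered′ x gx with ∨-elim (S x) gx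
      ... | inj₁ Sx = let (i , Eix) = covered x Sx in i , E⊆E′ i x Eix
      ... | inj₂ Cx = p , C⊆E′p x Cx
      within′ : ∀ i x → mergeAt E p i x ≡ true → grown x ≡ true
      within′ i x E′ix with ∨-elim (E i x) E′ix
      ... | inj₁ Eix = grown-old x (within i x Eix)
      ... | inj₂ pCx = grown-new x (∧-conicalʳ _ _ pCx)
      clique-in-block′ : ∀ Q → (∀ x → Q x ≡ true → grown x ≡ true) → IsClique Q →
        ∃ λ i → ∀ x → Q x ≡ true → mergeAt E p i x ≡ true
      clique-in-block′ Q Q⊆grown Q-clique with clique-old-or-new Q Q⊆grown Q-clique
      ... | inj₁ Q⊆S = let (i , Q⊆Ei) = clique-in-block Q Q⊆S Q-clique in i , λ x Qx → E⊆E′ i x (Q⊆Ei x Qx)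
      ... | inj₂ Q⊆C = p , λ x Qx → C⊆E′p x (Q⊆C x Qx)
      in-original : ∀ i j x → ¬ i ≡ j → mergeAt E p i x ≡ true → mergeAt E p j x ≡ true → E i x ≡ true
      in-original = merged-shared-is-old T p C∩S⊆Ep
      attached-once′ : ∀ i x y → mergeAt E p i x ≡ true → mergeAt E p i y ≡ true →
        InOlder (mergeAt E p) i x → InOlder (mergeAt E p) i y → x ≡ y
      attached-once′ i x y E′ix E′iy (j , i<j , E′jx) (j′ , i<j′ , E′j′y) =
        attached-once i x y (in-original i j x (Finₚ.<⇒≢ i<j) E′ix E′jx)
                            (in-original i j′ y (Finₚ.<⇒≢ i<j′) E′iy E′j′y)
          (j , i<j , in-original j i x (Finₚ.<⇒≢ i<j ∘ sym) E′jx E′ix)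
          (j′ , i<j′ , in-original j′ i y (Finₚ.<⇒≢ i<j′ ∘ sym) E′j′y E′iy)

  mergedBlocks : ∀ {a} → (Fin a → Clique (suc K)) → Fin a → Clique (suc K) → Fin a → Fin n → Bool
  mergedBlocks B host J i x = members (B i) x ∨ (does (i ≟ host) ∧ members J x)

  record TreeStage (S : Fin n → Bool) (a : ℕ) : Set where
    field
      cliques : Fin (suc a) → Clique (suc K)
      tree : BlockTree (suc a) (members ∘ cliques) S
      shape : Shape S a K
      missing : ∃ λ x → S x ≡ false

  record LStage (S : Fin n → Bool) (a s : ℕ) : Set where
    field
      cliques : Fin a → Clique (suc K)
      host : Fin a
      partner : Clique (suc K)
      tree : BlockTree a (mergedBlocks cliques host partner) S
      shape : Shape S a s
      partial-or-full : s < K ⊎ (∀ x → S x ≡ true)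
      forms-L : FormsL (cliques host) partner s

  record ExtremalStructure : Set where
    field
      cliques : Fin a∞ → Clique (suc K)
      host : Fin a∞
      partner : Clique (suc K)
      tree : BlockTree a∞ (mergedBlocks cliques host partner) (λ _ → true)
      forms-L : FormsL (cliques host) partner s∞

  private
    old≡1 : ∀ {old new} → old + new ≡ suc K → new ≡ K → old ≡ 1
    old≡1 {old} {new} old+new≡k refl = +-cancelʳ-≡ new old 1 old+new≡k

  module LStep {S a s} (stage : LStage S a s) {x} (Sx : S x ≡ false) (s<K : s < K)
               (fuel : ℕ) (enough : n ≤ count S + suc fuel) (tight : Tight S a s) where

    open LStage stage
    open Advance shape Sx public
    open TightAdvance (tight-advance fuel shape Sx enough tight)
    open TightExtension ext tight-ext

    private
      outcome : (new ≡ K) × (a′ ≡ suc a) × (s′ ≡ s)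
      outcome = tight-from-partial no-slack s<K

    stage′ : LStage grown (suc a) s
    stage′ = record
      { cliques = clique ∷ᶠ cliques ; host = suc host ; partner = partner
      ; tree = blockTree-cong (add-block tree (old≡1 old+new≡k (proj₁ outcome))) relabel (λ _ → refl)
      ; shape = subst₂ (Shape grown) (proj₁ (proj₂ outcome)) (proj₂ (proj₂ outcome)) shape′
      ; partial-or-full = inj₁ s<K
      ; forms-L = forms-L }
      where
      relabel : ∀ i x → (members clique ∷ᶠ mergedBlocks cliques host partner) i x
                      ≡ mergedBlocks (clique ∷ᶠ cliques) (suc host) partner i x
      relabel zero x = sym (∨-identityʳ (members clique x))
      relabel (suc i) x = refl

    tight″ : Tight grown (suc a) s
    tight″ = subst₂ (Tight grown) (proj₁ (proj₂ outcome)) (proj₂ (proj₂ outcome)) tight′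

  phase-two : ∀ fuel {S a s} → LStage S a s → n ≤ count S + fuel → Tight S a s → ExtremalStructure
  phase-two fuel {S} stage enough tight with full-or-missing S
  ... | inj₁ full with shape-full (LStage.shape stage) full
  ...   | refl , refl = record
    { cliques = cliques ; host = host ; partner = partner ; forms-L = forms-L
    ; tree = blockTree-cong tree (λ _ _ → refl) full }
    where open LStage stage
  phase-two zero stage enough tight | inj₂ (x , Sx) = contradiction enough (out-of-fuel Sx)
  phase-two (suc fuel) stage enough tight | inj₂ (x , Sx) with LStage.partial-or-full stage
  ... | inj₂ full = contradiction (trans (sym (full x)) Sx) λ ()
  ... | inj₁ s<K = phase-two fuel stage′ (fuel-step fuel enough) tight″
    where open LStep stage Sx s<K fuel enough tight

  module TreeStep {S a} (stage : TreeStage S a) {x} (Sx : S x ≡ false)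
                  (fuel : ℕ) (enough : n ≤ count S + suc fuel) (tight : Tight S a K) where

    open TreeStage stage
    open Advance shape Sx public
    open TightAdvance (tight-advance fuel shape Sx enough tight)
    open TightExtension ext tight-ext

    private
      outcome : (a′ ≡ suc a) × (s′ ≡ new) × (slack ≡ 0)
      outcome = from-full refl

    shape″ : Shape grown (suc a) new
    shape″ = subst₂ (Shape grown) (proj₁ outcome) (proj₁ (proj₂ outcome)) shape′

    tight″ : Tight grown (suc a) new
    tight″ = subst₂ (Tight grown) (proj₁ outcome) (proj₁ (proj₂ outcome)) tight′

    stage′ : new ≡ K → ∃ (λ z → grown z ≡ false) → TreeStage grown (suc a)
    stage′ new≡K missing′ = record
      { cliques = clique ∷ᶠ cliques
      ; tree = blockTree-cong (add-block tree (old≡1 old+new≡k new≡K)) relabel (λ _ → refl)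
      ; shape = subst (Shape grown (suc a)) new≡K shape″
      ; missing = missing′ }
      where
      relabel : ∀ i x → (members clique ∷ᶠ (members ∘ cliques)) i x ≡ (members ∘ (clique ∷ᶠ cliques)) i x
      relabel zero x = refl
      relabel (suc i) x = refl

    -- The new clique meets S in a clique, hence inside a single block: the host of the copy of L.
    private
      host-block : ∃ λ p → ∀ x → members clique x ∧ S x ≡ true → members (cliques p) x ≡ true
      host-block = BlockTree.clique-in-block tree (λ x → members clique x ∧ S x) (λ x → ∧-conicalʳ _ _)
        λ x y Cx Cy x≢y → members-adjacent clique x y (∧-conicalˡ _ _ Cx) (∧-conicalˡ _ _ Cy) x≢y
      p = proj₁ host-block
      C∩S⊆H = proj₂ host-block
      H = cliques p
      H⊆S : ∀ x → members H x ≡ true → S x ≡ true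
      H⊆S = BlockTree.within tree p

    forms-L : FormsL H clique new
    forms-L = record
      { shared = old
      ; shared+s≡k = old+new≡k
      ; count-shared = count-shared
      ; count-J-only = trans (count-cong λ x → squeeze-∧-not (inH x) (inC x) (S x) (H⊆S x) (C∩S⊆H x)) count-new
      ; count-H-only = count-H-only
      ; no-cross-edges = no-cross-edges }
      where
      inH inC : Fin n → Bool
      inH = members H
      inC = members clique
      count-shared : count (λ x → inH x ∧ inC x) ≡ old
      count-shared = trans (count-cong λ x → squeeze-∧ (inH x) (inC x) (S x) (H⊆S x) (C∩S⊆H x)) count-old
      H∖C : Fin n → Bool
      H∖C x = inH x ∧ not (inC x)
      count-H-only : count H∖C ≡ new
      count-H-only = +-cancelˡ-≡ old _ _ (begin
        old + count H∖C                      ≡⟨ cong (_+ count H∖C) count-shared ⟨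
        count (λ x → inH x ∧ inC x) + count H∖C ≡⟨ count-split inH inC ⟨
        count inH                            ≡⟨ count-members H ⟩
        suc K                                ≡⟨ old+new≡k ⟨
        old + new                            ∎)
        where open ≡-Reasoning
      no-cross-edges : ∀ x y → inH x ≡ true → inC x ≡ false → inC y ≡ true → inH y ≡ false → adj G x y ≡ false
      no-cross-edges x y Hx Cx Cy Hy = ¬-not λ xy → contradiction
        (tight-grown tight-ext x y x≢y xy (grown-old x (H⊆S x Hx)) (grown-new y Cy) Sy)
        (λ Cx′ → contradiction (trans (sym Cx′) Cx) λ ())
        where
        x≢y : ¬ x ≡ y
        x≢y refl = contradiction (trans (sym Cy) Cx) λ ()
        Sy : S y ≡ false
        Sy = ¬-not λ Sy′ → contradiction (trans (sym (C∩S⊆H y (cong₂ _∧_ Cy Sy′))) Hy) λ ()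

    L-stage : new < K ⊎ (∀ x → grown x ≡ true) → LStage grown (suc a) new
    L-stage partial-or-full = record
      { cliques = cliques ; host = p ; partner = clique
      ; tree = merge-block tree p C∩S⊆H
      ; shape = shape″
      ; partial-or-full = partial-or-full
      ; forms-L = forms-L }

  phase-one : ∀ fuel {S a} → TreeStage S a → n ≤ count S + fuel → Tight S a K → ExtremalStructure
  phase-one fuel {S} stage enough tight with full-or-missing S
  ... | inj₁ full = let (x , Sx) = TreeStage.missing stage in contradiction (trans (sym (full x)) Sx) λ ()
  phase-one zero stage enough tight | inj₂ (x , Sx) = contradiction enough (out-of-fuel Sx)
  phase-one (suc fuel) {S} {a} stage enough tight | inj₂ (x , Sx) = continue (new ≟ℕ K) (full-or-missing grown)
    where
    open TreeStep stage Sx fuel enough tight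
    continue : Dec (new ≡ K) → (∀ z → grown z ≡ true) ⊎ (∃ λ z → grown z ≡ false) → ExtremalStructure
    continue (yes new≡K) (inj₂ missing′) =
      phase-one fuel (stage′ new≡K missing′) (fuel-step fuel enough) (subst (Tight grown (suc a)) new≡K tight″)
    continue (yes new≡K) (inj₁ full) = phase-two fuel (L-stage (inj₂ full)) (fuel-step fuel enough) tight″
    continue (no new≢K) _ = phase-two fuel (L-stage (inj₁ (≤∧≢⇒< new≤K new≢K))) (fuel-step fuel enough) tight″

-- Induced copies of K_k and L

K-adjacent : ∀ k (a b : Fin k) → ¬ a ≡ b → adj (graph (K k)) a b ≡ true
K-adjacent k a b a≢b with a ≟ b
... | yes a≡b = contradiction a≡b a≢b
... | no _ = refl

<⇒<ᵇ≡true : ∀ {m n} → m < n → (m <ᵇ n) ≡ true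
<⇒<ᵇ≡true {zero} {suc n} _ = refl
<⇒<ᵇ≡true {suc m} {suc n} (s≤s m<n) = <⇒<ᵇ≡true m<n

≥⇒<ᵇ≡false : ∀ {m n} → n ≤ m → (m <ᵇ n) ≡ false
≥⇒<ᵇ≡false {m} {zero} _ = refl
≥⇒<ᵇ≡false {suc m} {suc n} (s≤s n≤m) = ≥⇒<ᵇ≡false n≤m

∈-tabulate⁺ : ∀ {n} (P : Fin n → Bool) {x} → P x ≡ true → x ∈ tabulate P
∈-tabulate⁺ P {x} Px = lookup⇒[]= x (tabulate P) (trans (lookup∘tabulate P x) Px)

∈-tabulate⁻ : ∀ {n} (P : Fin n → Bool) {x} → x ∈ tabulate P → P x ≡ true
∈-tabulate⁻ P {x} x∈P = trans (sym (lookup∘tabulate P x)) ([]=⇒lookup x∈P)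

module Copies {n : ℕ} (G : Graph n) where

  open Cliques G

  induced-K : ∀ {k} (cl : Clique k) (P : Fin n → Bool) → (∀ x → P x ≡ members cl x) → InducedIso G (tabulate P) (K k)
  induced-K {k} cl P P≡cl =
    vertex cl , injective cl , (λ a → ∈-tabulate⁺ P (trans (P≡cl _) (members-intro cl a))) ,
    (λ x x∈P → members-elim cl x (trans (sym (P≡cl x)) (∈-tabulate⁻ P x∈P))) , adj-eq
    where
    adj-eq : ∀ a b → adj (graph (K k)) a b ≡ adj G (vertex cl a) (vertex cl b)
    adj-eq a b with a ≟ b
    ... | yes refl = sym (adj-irref G (vertex cl a))
    ... | no a≢b = sym (adjacent cl a b a≢b)

  module LCopy {k s} {H J : Clique k} (forms-L : FormsL H J s) where

    open FormsL forms-L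

    H-only shared-by J-only : Fin n → Bool
    H-only x = members H x ∧ not (members J x)
    shared-by x = members H x ∧ members J x
    J-only x = members J x ∧ not (members H x)

    colour : Fin n → Bool × Bool
    colour x = members H x , members J x

    -- L k s numbers the vertices of H only first, then the shared ones, then those of J only.
    data Region (i : ℕ) : Set where
      H-part : i < s → Region i
      shared-part : s ≤ i → i < k → Region i
      J-part : k ≤ i → Region i

    region : ∀ i → Region i
    region i with i <? s
    ... | yes i<s = H-part i<s
    ... | no i≮s with i <? k
    ...   | yes i<k = shared-part (≮⇒≥ i≮s) i<k
    ...   | no i≮k = J-part (≮⇒≥ i≮k)

    regionColour : ∀ {i} → Region i → Bool × Bool
    regionColour (H-part _) = true , false
    regionColour (shared-part _ _) = true , true
    regionColour (J-part _) = false , true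

    s≤k : s ≤ k
    s≤k = ≤-trans (m≤n+m s shared) (≤-reflexive shared+s≡k)

    place : (a : Fin (k + s)) → Region (toℕ a) → Fin n
    place a (H-part a<s) = pick H-only (toℕ a) (subst (toℕ a <_) (sym count-H-only) a<s)
    place a (shared-part s≤a a<k) = pick shared-by (toℕ a ∸ s)
      (subst (toℕ a ∸ s <_) (trans (cong (_∸ s) (sym shared+s≡k)) (trans (m+n∸n≡m shared s) (sym count-shared)))
        (∸-monoˡ-< a<k s≤a))
    place a (J-part k≤a) = pick J-only (toℕ a ∸ k)
      (subst (toℕ a ∸ k <_) (trans (m+n∸m≡n k s) (sym count-J-only)) (∸-monoˡ-< (toℕ<n a) k≤a))

    embed : Fin (k + s) → Fin n
    embed a = place a (region (toℕ a))

    colour-place : ∀ a ρ → colour (place a ρ) ≡ regionColour ρ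
    colour-place a (H-part _) = H-only-colour _ (pick-member H-only _ _)
      where
      H-only-colour : ∀ x → H-only x ≡ true → colour x ≡ (true , false)
      H-only-colour x _ with members H x | members J x
      H-only-colour x refl | true | false = refl
    colour-place a (shared-part _ _) = shared-colour _ (pick-member shared-by _ _)
      where
      shared-colour : ∀ x → shared-by x ≡ true → colour x ≡ (true , true)
      shared-colour x _ with members H x | members J x
      shared-colour x refl | true | true = refl
    colour-place a (J-part _) = J-only-colour _ (pick-member J-only _ _)
      where
      J-only-colour : ∀ x → J-only x ≡ true → colour x ≡ (false , true)
      J-only-colour x _ with members J x | members H x
      J-only-colour x refl | true | false = refl

    index-colour : ∀ {i} (ρ : Region i) → ((i <ᵇ k) , (s <ᵇ suc i)) ≡ regionColour ρ
    index-colour (H-part i<s) = cong₂ _,_ (<⇒<ᵇ≡true (≤-trans i<s s≤k)) (≥⇒<ᵇ≡false i<s)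
    index-colour (shared-part s≤i i<k) = cong₂ _,_ (<⇒<ᵇ≡true i<k) (<⇒<ᵇ≡true (s≤s s≤i))
    index-colour (J-part k≤i) = cong₂ _,_ (≥⇒<ᵇ≡false k≤i) (<⇒<ᵇ≡true (s≤s (≤-trans s≤k k≤i)))

    colour-embed : ∀ a → colour (embed a) ≡ ((toℕ a <ᵇ k) , (s <ᵇ suc (toℕ a)))
    colour-embed a = trans (colour-place a (region (toℕ a))) (sym (index-colour (region (toℕ a))))

    place-injective : ∀ a b ρ σ → place a ρ ≡ place b σ → toℕ a ≡ toℕ b
    place-injective a b ρ σ eq =
      same-region ρ σ eq (trans (sym (colour-place a ρ)) (trans (cong colour eq) (colour-place b σ)))
      where
      same-region : ∀ ρ σ → place a ρ ≡ place b σ → regionColour ρ ≡ regionColour σ → toℕ a ≡ toℕ b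
      same-region (H-part _) (H-part _) eq _ = pick-injective H-only _ _ _ _ eq
      same-region (shared-part s≤a _) (shared-part s≤b _) eq _ =
        ∸-cancelʳ-≡ s≤a s≤b (pick-injective shared-by _ _ _ _ eq)
      same-region (J-part k≤a) (J-part k≤b) eq _ = ∸-cancelʳ-≡ k≤a k≤b (pick-injective J-only _ _ _ _ eq)
      same-region (H-part _) (shared-part _ _) _ ()
      same-region (H-part _) (J-part _) _ ()
      same-region (shared-part _ _) (H-part _) _ ()
      same-region (shared-part _ _) (J-part _) _ ()
      same-region (J-part _) (H-part _) _ ()
      same-region (J-part _) (shared-part _ _) _ ()

    embed-injective : Injective _≡_ _≡_ embed
    embed-injective {a} {b} eq = toℕ-injective (place-injective a b (region (toℕ a)) (region (toℕ b)) eq)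

    embed-into : ∀ a → members H (embed a) ∨ members J (embed a) ≡ true
    embed-into a =
      trans (cong (λ c → proj₁ c ∨ proj₂ c) (colour-place a (region (toℕ a)))) (coloured (region (toℕ a)))
      where
      coloured : ∀ {i} (ρ : Region i) → proj₁ (regionColour ρ) ∨ proj₂ (regionColour ρ) ≡ true
      coloured (H-part _) = refl
      coloured (shared-part _ _) = refl
      coloured (J-part _) = refl

    embed-onto : ∀ x → members H x ∨ members J x ≡ true → ∃ λ a → embed a ≡ x
    embed-onto = injection-onto embed embed-injective (λ x → members H x ∨ members J x) embed-into
      (≤-reflexive (trans (count-∨ (members H) (members J)) (cong₂ _+_ (count-members H) count-J-only)))

    no-edge-between : ∀ x y → members H x ∨ members J x ≡ true → members H y ∨ members J y ≡ true →
      members H x ∧ members H y ≡ false → members J x ∧ members J y ≡ false → adj G x y ≡ false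
    no-edge-between x y x∈ y∈ ¬HH ¬JJ with members H x in Hx | members J x in Jx | members H y in Hy | members J y in Jy
    ... | true  | false | false | true  = no-cross-edges x y Hx Jx Jy Hy
    ... | false | true  | true  | false = trans (adj-sym G x y) (no-cross-edges y x Hy Jy Jx Hx)
    ... | true  | _     | true  | _     = contradiction ¬HH λ ()
    ... | _     | true  | _     | true  = contradiction ¬JJ λ ()
    ... | false | false | _     | _     = contradiction x∈ λ ()
    ... | _     | _     | false | false = contradiction y∈ λ ()

    adj-union : ∀ x y → ¬ x ≡ y → members H x ∨ members J x ≡ true → members H y ∨ members J y ≡ true →
      adj G x y ≡ (members H x ∧ members H y) ∨ (members J x ∧ members J y)
    adj-union x y x≢y x∈ y∈ with members H x ∧ members H y in HH
    ... | true = members-adjacent H x y (∧-conicalˡ _ _ HH) (∧-conicalʳ _ _ HH) x≢y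
    ... | false with members J x ∧ members J y in JJ
    ...   | true = members-adjacent J x y (∧-conicalˡ _ _ JJ) (∧-conicalʳ _ _ JJ) x≢y
    ...   | false = no-edge-between x y x∈ y∈ HH JJ

    induced-L : (P : Fin n → Bool) → (∀ x → P x ≡ (members H x ∨ members J x)) → InducedIso G (tabulate P) (L k s)
    induced-L P P≡H∪J =
      embed , embed-injective , (λ a → ∈-tabulate⁺ P (trans (P≡H∪J _) (embed-into a))) ,
      (λ x x∈P → embed-onto x (trans (sym (P≡H∪J x)) (∈-tabulate⁻ P x∈P))) , adj-eq
      where
      adj-eq : ∀ a b → adj (graph (L k s)) a b ≡ adj G (embed a) (embed b)
      adj-eq a b with a ≟ b
      ... | yes refl = sym (adj-irref G (embed a))
      ... | no a≢b = begin
        ((toℕ a <ᵇ k) ∧ (toℕ b <ᵇ k)) ∨ ((s <ᵇ suc (toℕ a)) ∧ (s <ᵇ suc (toℕ b)))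
          ≡⟨ cong₂ (λ ca cb → (proj₁ ca ∧ proj₁ cb) ∨ (proj₂ ca ∧ proj₂ cb))
                   (colour-embed a) (colour-embed b) ⟨
        (members H (embed a) ∧ members H (embed b)) ∨ (members J (embed a) ∧ members J (embed b))
          ≡⟨ adj-union (embed a) (embed b) (a≢b ∘ embed-injective) (embed-into a) (embed-into b) ⟨
        adj G (embed a) (embed b)
          ∎
        where open ≡-Reasoning

-- The blocks form a linear hypertree

∣∣≡count : ∀ {n} (S : Subset n) → ∣ S ∣ ≡ count (lookup S)
∣∣≡count [] = refl
∣∣≡count (true ∷ S) = cong suc (∣∣≡count S)
∣∣≡count (false ∷ S) = ∣∣≡count S

∣∣≤1⇒unique : ∀ {n} (S : Subset n) → ∣ S ∣ ≤ 1 → ∀ {x y} → x ∈ S → y ∈ S → x ≡ y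
∣∣≤1⇒unique S ∣S∣≤1 x∈S y∈S =
  count≤1⇒unique (lookup S) (subst (_≤ 1) (∣∣≡count S) ∣S∣≤1) _ _ ([]=⇒lookup x∈S) ([]=⇒lookup y∈S)

unique⇒∣∣≤1 : ∀ {n} (S : Subset n) → (∀ {x y} → x ∈ S → y ∈ S → x ≡ y) → ∣ S ∣ ≤ 1
unique⇒∣∣≤1 S unique = subst (_≤ 1) (sym (∣∣≡count S))
  (count≤1 (lookup S) λ x y Sx Sy → unique (lookup⇒[]= x S Sx) (lookup⇒[]= y S Sy))

argmin : ∀ {l} (h : Fin (suc l) → ℕ) → ∃ λ i → ∀ j → h i ≤ h j
argmin {zero} h = zero , λ { zero → ≤-refl }
argmin {suc l} h with argmin (h ∘ suc)
... | i , min with h zero ≤? h (suc i)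
...   | yes h0≤ = zero , λ { zero → ≤-refl ; (suc j) → ≤-trans h0≤ (min j) }
...   | no h0≰ = suc i , λ { zero → <⇒≤ (≰⇒> h0≰) ; (suc j) → min j }

next-≢ : ∀ {l} → 1 ≤ l → (i : Fin (suc l)) → ¬ next i ≡ i
next-≢ {l} 1≤l i next≡i with suc (toℕ i) ≤? l
... | yes i<l = 1+n≢n (trans (sym (m<n⇒m%n≡m (s≤s i<l))) (trans (sym (toℕ-fromℕ< _)) (cong toℕ next≡i)))
... | no i≮l = <⇒≢ 1≤l (sym (begin
  l                     ≡⟨ i≡l ⟨
  toℕ i                 ≡⟨ cong toℕ next≡i ⟨
  toℕ (next i)          ≡⟨ toℕ-fromℕ< _ ⟩
  suc (toℕ i) % suc l   ≡⟨ cong (λ m → suc m % suc l) i≡l ⟩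
  suc l % suc l         ≡⟨ n%n≡0 (suc l) ⟩
  0                     ∎))
  where
  open ≡-Reasoning
  i≡l : toℕ i ≡ l
  i≡l = ≤-antisym (≤-pred (toℕ<n i)) (≮⇒≥ i≮l)

previous : ∀ {l} (i : Fin (suc l)) → ∃ λ p → next p ≡ i
previous {l} zero =
  fromℕ l , toℕ-injective (trans (toℕ-fromℕ< _) (trans (cong (λ m → suc m % suc l) (toℕ-fromℕ l)) (n%n≡0 (suc l))))
previous {suc l} (suc i) = inject₁ i , toℕ-injective
  (trans (toℕ-fromℕ< _) (trans (cong (λ m → suc m % suc (suc l)) (toℕ-inject₁ i)) (m<n⇒m%n≡m (s≤s (toℕ<n i)))))

module Hypertrees {n : ℕ} (G : Graph n) where

  open BlockTrees G

  module _ {b} {E : Fin b → Fin n → Bool} (T : BlockTree b E (λ _ → true)) where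

    open BlockTree T

    shared-vertex-unique : ∀ i j x y → ¬ i ≡ j →
      E i x ≡ true → E j x ≡ true → E i y ≡ true → E j y ≡ true → x ≡ y
    shared-vertex-unique i j x y i≢j Eix Ejx Eiy Ejy with <-cmp (toℕ i) (toℕ j)
    ... | tri< i<j _ _ = attached-once i x y Eix Eiy (j , i<j , Ejx) (j , i<j , Ejy)
    ... | tri≈ _ i≡j _ = contradiction (toℕ-injective i≡j) i≢j
    ... | tri> _ _ j<i = attached-once j x y Ejx Ejy (i , j<i , Eix) (i , j<i , Eiy)

    edge-in-block : ∀ u v → adj G u v ≡ true → ∃ λ i → E i u ≡ true × E i v ≡ true
    edge-in-block u v uv = let (i , Q⊆Ei) = clique-in-block Q (λ _ _ → refl) Q-clique in
      i , Q⊆Ei u (cong (_∨ does (u ≟ v)) (dec-true (u ≟ u) refl))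
        , Q⊆Ei v (trans (cong (does (v ≟ u) ∨_) (dec-true (v ≟ v) refl)) (∨-zeroʳ _))
      where
      Q : Fin n → Bool
      Q z = does (z ≟ u) ∨ does (z ≟ v)
      endpoint : ∀ z → Q z ≡ true → z ≡ u ⊎ z ≡ v
      endpoint z Qz with z ≟ u | z ≟ v
      ... | yes z≡u | _ = inj₁ z≡u
      ... | no _ | yes z≡v = inj₂ z≡v
      Q-clique : IsClique Q
      Q-clique x y Qx Qy x≢y with endpoint x Qx | endpoint y Qy
      ... | inj₁ refl | inj₁ refl = contradiction refl x≢y
      ... | inj₁ refl | inj₂ refl = uv
      ... | inj₂ refl | inj₁ refl = trans (adj-sym G v u) uv
      ... | inj₂ refl | inj₂ refl = contradiction refl x≢y

    -- The newest block of a cycle meets the older blocks before and after it in two distinct cycle vertices.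
    no-cycle-of-blocks : ∀ {l} → 1 ≤ l → (c : Fin (suc l) → Fin b) → Injective _≡_ _≡_ c →
      (v : Fin (suc l) → Fin n) → Injective _≡_ _≡_ v →
      (∀ i → E (c i) (v i) ≡ true × E (c (next i)) (v i) ≡ true) → ⊥
    no-cycle-of-blocks 1≤l c c-inj v v-inj on-cycle = p≢newest (v-inj vp≡v-newest)
      where
      newest = proj₁ (argmin (toℕ ∘ c))
      older : ∀ j → ¬ j ≡ newest → toℕ (c newest) < toℕ (c j)
      older j j≢newest = ≤∧≢⇒< (proj₂ (argmin (toℕ ∘ c)) j) λ eq → j≢newest (sym (c-inj (toℕ-injective eq)))
      p = proj₁ (previous newest)
      next-p : next p ≡ newest
      next-p = proj₂ (previous newest)
      p≢newest : ¬ p ≡ newest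
      p≢newest p≡newest = next-≢ 1≤l p (trans next-p (sym p≡newest))
      vp≡v-newest : v p ≡ v newest
      vp≡v-newest = attached-once (c newest) (v p) (v newest)
        (subst (λ j → E (c j) (v p) ≡ true) next-p (proj₂ (on-cycle p))) (proj₁ (on-cycle newest))
        (c p , older p p≢newest , proj₁ (on-cycle p))
        (c (next newest) , older (next newest) (next-≢ 1≤l newest) , proj₂ (on-cycle newest))

    module Relabelled (π : Permutation b b) where

      hyperedges : Hyperedges n b
      hyperedges i = tabulate (E (π ⟨$⟩ʳ i))

      ∈-hyperedge : ∀ j x → E j x ≡ true → x ∈ hyperedges (π ⟨$⟩ˡ j)
      ∈-hyperedge j x Ejx = ∈-tabulate⁺ _ (subst (λ j′ → E j′ x ≡ true) (sym (inverseʳ π)) Ejx)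

      π-injective : Injective _≡_ _≡_ (π ⟨$⟩ʳ_)
      π-injective eq = trans (sym (inverseˡ π)) (trans (cong (π ⟨$⟩ˡ_) eq) (inverseˡ π))

      linear : Linear hyperedges
      linear i j i≢j = unique⇒∣∣≤1 (hyperedges i ∩ hyperedges j) λ x∈ y∈ →
        let (x∈i , x∈j) = x∈p∩q⁻ _ _ x∈ ; (y∈i , y∈j) = x∈p∩q⁻ _ _ y∈ in
        shared-vertex-unique (π ⟨$⟩ʳ i) (π ⟨$⟩ʳ j) _ _ (i≢j ∘ π-injective)
          (∈-tabulate⁻ _ x∈i) (∈-tabulate⁻ _ x∈j) (∈-tabulate⁻ _ y∈i) (∈-tabulate⁻ _ y∈j)

      covers-edges : ∀ u v → adj G u v ≡ true → Σ (Fin b) λ i → u ∈ hyperedges i × v ∈ hyperedges i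
      covers-edges u v uv =
        let (j , Eju , Ejv) = edge-in-block u v uv in π ⟨$⟩ˡ j , ∈-hyperedge j u Eju , ∈-hyperedge j v Ejv

      hyperwalk : ∀ {u v} → Walk G u v → HWalk hyperedges u v
      hyperwalk here = here
      hyperwalk (step {u} {w} uw rest) = let (i , u∈ , w∈) = covers-edges u w uw in step i u∈ w∈ (hyperwalk rest)

      acyclic : ¬ HCycle hyperedges
      acyclic (l , 1≤l , c , v , c-inj , v-inj , on-cycle) =
        no-cycle-of-blocks 1≤l ((π ⟨$⟩ʳ_) ∘ c) (c-inj ∘ π-injective) v v-inj
          λ i → ∈-tabulate⁻ _ (proj₁ (on-cycle i)) , ∈-tabulate⁻ _ (proj₂ (on-cycle i))

      hypertree : Connected G → Hypertree hyperedges
      hypertree connected = (λ u v → hyperwalk (connected u v)) , acyclic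

-- Edge counts of graphs in 𝒢_tree

+-double-injective : ∀ x y → x + x ≡ y + y → x ≡ y
+-double-injective x y eq =
  *-cancelˡ-≡ x y 2 (trans (cong (x +_) (+-identityʳ x)) (trans eq (cong (y +_) (sym (+-identityʳ y)))))

module _ {n : ℕ} (G : Graph n) where

  open Cliques G

  private
    χ-∧∧ : ∀ a b c → χ (a ∧ b ∧ c) ≡ (if a then (if b then χ c else 0) else 0)
    χ-∧∧ true true c = refl
    χ-∧∧ true false c = refl
    χ-∧∧ false b c = refl

    sum-if : ∀ b (h : Fin n → ℕ) → sum (λ v → if b then h v else 0) ≡ (if b then sum h else 0)
    sum-if true h = refl
    sum-if false h = sum-zero {n} (λ _ → 0) λ _ → refl

  edgesIn-induced : (S : Subset n) (F : SGraph) → InducedIso G S F → edgesIn (lookup S) ≡ edgeCount (graph F)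
  edgesIn-induced S F (f , f-inj , into , onto , adj-eq) = +-double-injective _ _ (begin
    edgesIn X + edgesIn X
      ≡⟨ sum²≡sumPairs+sumPairs P (edgesIn-symmetric X) P-diagonal ⟨
    sum (λ u → sum (λ v → P u v))
      ≡⟨ sum-cong-≗ (λ u → trans (sum-cong-≗ λ v → χ-∧∧ (X u) (X v) (adj G u v)) (sum-if (X u) _)) ⟩
    sum (λ u → if X u then sum (λ v → if X v then χ (adj G u v) else 0) else 0)
      ≡⟨ sum-image f f-inj X onto′ into′ (λ u → sum (λ v → if X v then χ (adj G u v) else 0)) ⟩
    sum (λ a → sum (λ v → if X v then χ (adj G (f a) v) else 0))
      ≡⟨ sum-cong-≗ (λ a → sum-image f f-inj X onto′ into′ (λ v → χ (adj G (f a) v))) ⟩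
    sum (λ a → sum (λ b → χ (adj G (f a) (f b))))
      ≡⟨ sum-cong-≗ (λ a → sum-cong-≗ λ b → cong χ (adj-eq a b)) ⟨
    sum (λ a → sum (λ b → χ (adj (graph F) a b)))
      ≡⟨ sum²≡sumPairs+sumPairs (λ a b → χ (adj (graph F) a b))
                                (λ a b → cong χ (adj-sym (graph F) a b)) (λ a → cong χ (adj-irref (graph F) a)) ⟩
    sumPairs (λ a b → χ (adj (graph F) a b)) + sumPairs (λ a b → χ (adj (graph F) a b))
      ≡⟨ cong₂ _+_ (edgeCount≡sumPairs (graph F)) (edgeCount≡sumPairs (graph F)) ⟨
    edgeCount (graph F) + edgeCount (graph F)
      ∎)
    where
    open ≡-Reasoning
    X = lookup S
    P : Fin n → Fin n → ℕ
    P u v = χ (X u ∧ X v ∧ adj G u v)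
    P-diagonal : ∀ u → P u u ≡ 0
    P-diagonal u rewrite adj-irref G u | ∧-zeroʳ (X u) | ∧-zeroʳ (X u) = refl
    onto′ : ∀ x → X x ≡ true → Σ (Fin (size F)) λ a → f a ≡ x
    onto′ x Xx = onto x (lookup⇒[]= x S Xx)
    into′ : ∀ a → X (f a) ≡ true
    into′ a = []=⇒lookup (into a)

edgeCount-K : ∀ k → edgeCount (graph (K k)) ≡ choose2 k
edgeCount-K k = begin
  edgeCount (graph (K k))                        ≡⟨ edgeCount≡sumPairs (graph (K k)) ⟩
  sumPairs (λ a b → χ (adj (graph (K k)) a b))   ≡⟨ sumPairs-cong (λ a b a≢b → cong χ (K-adjacent k a b a≢b)) ⟩
  sumPairs {k} (λ _ _ → χ (true ∧ true))         ≡⟨ sumPairs-square {k} (λ _ → true) ⟩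
  choose2 (count {k} (λ _ → true))               ≡⟨ cong choose2 (count-all {k} (λ _ → true) (λ _ → refl)) ⟩
  choose2 k                                      ∎
  where open ≡-Reasoning

countBelow : ℕ → (ℕ → Bool) → ℕ
countBelow zero p = 0
countBelow (suc m) p = χ (p 0) + countBelow m (p ∘ suc)

count-toℕ : ∀ {m} (p : ℕ → Bool) → count {m} (p ∘ toℕ) ≡ countBelow m p
count-toℕ {zero} p = refl
count-toℕ {suc m} p = cong (χ (p 0) +_) (count-toℕ {m} (p ∘ suc))

countBelow-const : ∀ m b → countBelow m (λ _ → b) ≡ m * χ b
countBelow-const zero b = refl
countBelow-const (suc m) b = cong (χ b +_) (countBelow-const m b)

countBelow-< : ∀ a b → countBelow (a + b) (_<ᵇ a) ≡ a
countBelow-< zero b = trans (countBelow-const b false) (*-zeroʳ b)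
countBelow-< (suc a) b = cong suc (countBelow-< a b)

countBelow-≥ : ∀ r b → countBelow (r + b) (λ i → r <ᵇ suc i) ≡ b
countBelow-≥ zero b = trans (countBelow-const b true) (*-identityʳ b)
countBelow-≥ (suc r) b = countBelow-≥ r b

countBelow-between : ∀ r c b → countBelow (r + c + b) (λ i → (i <ᵇ r + c) ∧ (r <ᵇ suc i)) ≡ c
countBelow-between zero c b = trans (countBelow-cong (c + b) λ i → ∧-identityʳ (i <ᵇ c)) (countBelow-< c b)
  where
  countBelow-cong : ∀ m {p p′ : ℕ → Bool} → (∀ i → p i ≡ p′ i) → countBelow m p ≡ countBelow m p′
  countBelow-cong zero _ = refl
  countBelow-cong (suc m) p≡p′ = cong₂ _+_ (cong χ (p≡p′ 0)) (countBelow-cong m (p≡p′ ∘ suc))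
countBelow-between (suc r) c b = countBelow-between r c b

module _ (k r : ℕ) where

  L-first L-second : Fin (k + r) → Bool
  L-first a = toℕ a <ᵇ k
  L-second a = r <ᵇ suc (toℕ a)

  count-L-first : count L-first ≡ k
  count-L-first = trans (count-toℕ {k + r} (_<ᵇ k)) (countBelow-< k r)

  count-L-second : count L-second ≡ k
  count-L-second = trans (count-toℕ {k + r} (λ i → r <ᵇ suc i))
                         (trans (cong (λ N → countBelow N (λ i → r <ᵇ suc i)) (+-comm k r)) (countBelow-≥ r k))

  count-L-shared : ∀ m → m + r ≡ k → count (λ a → L-first a ∧ L-second a) ≡ m
  count-L-shared m m+r≡k = trans (count-toℕ {k + r} (λ i → (i <ᵇ k) ∧ (r <ᵇ suc i)))
    (subst (λ k → countBelow (k + r) (λ i → (i <ᵇ k) ∧ (r <ᵇ suc i)) ≡ m) (trans (+-comm r m) m+r≡k)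
           (countBelow-between r m r))

  -- Pairs inside either copy of K_k, by inclusion–exclusion over the m = k - r shared vertices.
  edgeCount-L : ∀ m → m + r ≡ k → edgeCount (graph (L k r)) + choose2 m ≡ choose2 k + choose2 k
  edgeCount-L m m+r≡k = begin
    edgeCount (graph (L k r)) + choose2 m
      ≡⟨ cong₂ _+_ (trans (edgeCount≡sumPairs (graph (L k r))) (sumPairs-cong λ a b a≢b →
                     cong (λ e → χ (e ∧ (AA a b ∨ BB a b))) (K-adjacent (k + r) a b a≢b)))
                   (sym both-pairs) ⟩
    sumPairs (λ a b → χ (AA a b ∨ BB a b)) + sumPairs (λ a b → χ (AA a b ∧ BB a b))
      ≡⟨ sumPairs-+ (λ a b → χ (AA a b ∨ BB a b)) (λ a b → χ (AA a b ∧ BB a b)) ⟨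
    sumPairs (λ a b → χ (AA a b ∨ BB a b) + χ (AA a b ∧ BB a b))
      ≡⟨ sumPairs-cong (λ a b _ → χ-∨+χ-∧ (AA a b) (BB a b)) ⟩
    sumPairs (λ a b → χ (AA a b) + χ (BB a b))
      ≡⟨ sumPairs-+ (λ a b → χ (AA a b)) (λ a b → χ (BB a b)) ⟩
    sumPairs (λ a b → χ (AA a b)) + sumPairs (λ a b → χ (BB a b))
      ≡⟨ cong₂ _+_ (trans (sumPairs-square L-first) (cong choose2 count-L-first))
                   (trans (sumPairs-square L-second) (cong choose2 count-L-second)) ⟩
    choose2 k + choose2 k
      ∎
    where
    open ≡-Reasoning
    AA BB : Fin (k + r) → Fin (k + r) → Bool
    AA a b = L-first a ∧ L-first b
    BB a b = L-second a ∧ L-second b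
    χ-∨+χ-∧ : ∀ x y → χ (x ∨ y) + χ (x ∧ y) ≡ χ x + χ y
    χ-∨+χ-∧ true true = refl
    χ-∨+χ-∧ true false = refl
    χ-∨+χ-∧ false y = +-identityʳ (χ y)
    interchange-∧ : ∀ a b c d → (a ∧ b) ∧ (c ∧ d) ≡ (a ∧ c) ∧ (b ∧ d)
    interchange-∧ true b c d = ∧-swap b c d
    interchange-∧ false b c d = refl
    both-pairs : sumPairs (λ a b → χ (AA a b ∧ BB a b)) ≡ choose2 m
    both-pairs = trans (sumPairs-cong λ a b _ → cong χ (interchange-∧ (L-first a) (L-first b) (L-second a) (L-second b)))
                       (trans (sumPairs-square (λ a → L-first a ∧ L-second a)) (cong choose2 (count-L-shared m m+r≡k)))

sum-family : ∀ q k r (h : SGraph → ℕ) → sum (λ i → h (famQKL q k r i)) ≡ q * h (K k) + h (L k r)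
sum-family zero k r h = +-identityʳ (h (L k r))
sum-family (suc q) k r h =
  trans (cong (h (K k) +_) (trans (sum-cong-≗ (cong h ∘ famQKL-suc)) (sum-family q k r h))) (sym (+-assoc (h (K k)) _ _))
  where
  famQKL-suc : ∀ i → famQKL (suc q) k r (suc i) ≡ famQKL q k r i
  famQKL-suc i with i ≟ fromℕ q
  ... | yes _ = refl
  ... | no _ = refl

module _ {n : ℕ} (G : Graph n) where

  open Cliques G

  edgeCount-Gtree : ∀ q k r → InGtree (suc q) (famQKL q k r) G →
    edgeCount G ≡ q * choose2 k + edgeCount (graph (L k r))
  edgeCount-Gtree q k r (E , linear , _ , covers , induced) = begin
    edgeCount G                                              ≡⟨ edgeCount≡sumPairs G ⟩
    sumPairs (λ u v → χ (adj G u v))                         ≡⟨ sumPairs-cong in-one-hyperedge ⟩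
    sumPairs (λ u v → sum (λ i → P i u v))                   ≡⟨ sumPairs-sum P ⟩
    sum (λ i → edgesIn (X i))                                ≡⟨ sum-cong-≗ (λ i → edgesIn-induced G (E i) (F i) (induced i)) ⟩
    sum (λ i → edgeCount (graph (F i)))                      ≡⟨ sum-family q k r (edgeCount ∘ graph) ⟩
    q * edgeCount (graph (K k)) + eL                         ≡⟨ cong (λ e → q * e + eL) (edgeCount-K k) ⟩
    q * choose2 k + eL                                       ∎
    where
    open ≡-Reasoning
    F = famQKL q k r
    eL = edgeCount (graph (L k r))
    X : Fin (suc q) → Fin n → Bool
    X i = lookup (E i)
    P : Fin (suc q) → Fin n → Fin n → ℕ
    P i u v = χ (X i u ∧ X i v ∧ adj G u v)
    χ-∧-false : ∀ a b → χ (a ∧ b ∧ false) ≡ 0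
    χ-∧-false true true = refl
    χ-∧-false true false = refl
    χ-∧-false false b = refl
    in-one-hyperedge : ∀ u v → ¬ u ≡ v → χ (adj G u v) ≡ sum (λ i → χ (X i u ∧ X i v ∧ adj G u v))
    in-one-hyperedge u v u≢v with adj G u v in uv
    ... | false = sym (sum-zero _ λ i → χ-∧-false (X i u) (X i v))
    ... | true with covers u v uv
    ...   | i₀ , u∈ , v∈ =
      sym (trans (sum-single _ i₀ elsewhere) (cong₂ (λ a b → χ (a ∧ b ∧ true)) ([]=⇒lookup u∈) ([]=⇒lookup v∈)))
      where
      elsewhere : ∀ i → ¬ i ≡ i₀ → χ (X i u ∧ X i v ∧ true) ≡ 0
      elsewhere i i≢i₀ with X i u in Xiu | X i v in Xiv
      ... | true | true = contradiction (∣∣≤1⇒unique _ (linear i i₀ i≢i₀)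
                            (x∈p∩q⁺ (lookup⇒[]= u (E i) Xiu , u∈)) (x∈p∩q⁺ (lookup⇒[]= v (E i) Xiv , v∈))) u≢v
      ... | true | false = refl
      ... | false | _ = refl

edgeCount-L-split : ∀ K r → r ≤ K → edgeCount (graph (L (suc K) r)) ≡ choose2 (suc K) + newEdges (suc (K ∸ r)) r
edgeCount-L-split K r r≤K = +-cancelʳ-≡ (choose2 kept) _ _ (begin
  edgeCount (graph (L (suc K) r)) + choose2 kept     ≡⟨ edgeCount-L (suc K) r kept (cong suc (m∸n+n≡m r≤K)) ⟩
  choose2 (suc K) + choose2 (suc K)               ≡⟨ cong (choose2 (suc K) +_) (choose2-split K r r≤K) ⟩
  choose2 (suc K) + (choose2 kept + newEdges kept r)    ≡⟨ cong (choose2 (suc K) +_) (+-comm (choose2 kept) (newEdges kept r)) ⟩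
  choose2 (suc K) + (newEdges kept r + choose2 kept)    ≡⟨ +-assoc (choose2 (suc K)) (newEdges kept r) (choose2 kept) ⟨
  choose2 (suc K) + newEdges kept r + choose2 kept      ∎)
  where
  open ≡-Reasoning
  kept = suc (K ∸ r)

Gtree-edgeCount≡minEdges : ∀ K q r → r ≤ K →
  q * choose2 (suc K) + edgeCount (graph (L (suc K) r)) ≡ minEdges K (suc q) r
Gtree-edgeCount≡minEdges K q r r≤K = begin
  q * c + edgeCount (graph (L (suc K) r))   ≡⟨ cong (q * c +_) (edgeCount-L-split K r r≤K) ⟩
  q * c + (c + N)                           ≡⟨ +-assoc (q * c) c N ⟨
  q * c + c + N                             ≡⟨ cong (_+ N) (+-comm (q * c) c) ⟩
  c + q * c + N                             ∎
  where
  open ≡-Reasoning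
  c = choose2 (suc K)
  N = newEdges (suc (K ∸ r)) r

transpose-target : ∀ {m} (i j : Fin m) → PC.transpose i j j ≡ i
transpose-target i j with j ≟ i
... | yes j≡i = j≡i
... | no _ with j ≟ j
...   | yes _ = refl
...   | no j≢j = contradiction refl j≢j

module Proof (K : ℕ) {n : ℕ} (G : Graph n) (connected : Connected G) (cover : HasK1Cover (suc K) G)
             (q r : ℕ) (n≡ : n ≡ suc (suc q * K + r)) (1≤r : 1 ≤ r) (r≤K : r ≤ K) where

  open Extremal K G connected cover (suc q) r n≡ 1≤r r≤K public
  open Copies G
  open Hypertrees G

  private
    k<n : suc K < n
    k<n = subst (suc K <_) (sym n≡) (s≤s (≤-trans (m<m+n K 1≤r) (+-monoˡ-≤ r (m≤m+n K (q * K)))))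
    0<n : 0 < n
    0<n = ≤-trans (s≤s z≤n) k<n
    1<n : 1 < n
    1<n = ≤-trans (s≤s (s≤s z≤n)) (≤-trans (s≤s (≤-trans 1≤r r≤K)) (<⇒≤ k<n))
    x₀ x₁ : Fin n
    x₀ = fromℕ< 0<n
    x₁ = fromℕ< 1<n
    x₁≢x₀ : ¬ x₁ ≡ x₀
    x₁≢x₀ eq = 1+n≢0 (trans (sym (toℕ-fromℕ< 1<n)) (trans (cong toℕ eq) (toℕ-fromℕ< 0<n)))

  C₀ : Clique (suc K)
  C₀ = Extension.clique
         (extend (λ x → does (x ≟ x₀)) {x₀} {x₁} (dec-true (x₀ ≟ x₀) refl) (dec-false (x₁ ≟ x₀) x₁≢x₀))

  S₀ : Fin n → Bool
  S₀ = members C₀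

  shape₀ : Shape S₀ 0 K
  shape₀ = record { has-size = count-members C₀ ; 1≤s = ≤-trans 1≤r r≤K ; s≤K = ≤-refl }

  minEdges-start : minEdges K 0 K ≡ edgesIn S₀
  minEdges-start = begin
    choose2 K + suc (K ∸ K) * K    ≡⟨ cong (λ m → choose2 K + suc m * K) (n∸n≡0 K) ⟩
    choose2 K + (K + 0)            ≡⟨ cong (choose2 K +_) (+-identityʳ K) ⟩
    choose2 K + K                  ≡⟨ +-comm (choose2 K) K ⟩
    choose2 (suc K)                ≡⟨ edgesIn-members C₀ ⟨
    edgesIn S₀                     ∎
    where open ≡-Reasoning

  target≤edgeCount : target ≤ edgeCount G
  target≤edgeCount = +-cancelˡ-≤ (edgesIn S₀) target (edgeCount G) (begin
    edgesIn S₀ + target            ≤⟨ lower-bound n shape₀ (m≤n+m n (count S₀)) ⟩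
    edgeCount G + minEdges K 0 K   ≡⟨ cong (edgeCount G +_) minEdges-start ⟩
    edgeCount G + edgesIn S₀       ≡⟨ +-comm (edgeCount G) (edgesIn S₀) ⟩
    edgesIn S₀ + edgeCount G       ∎)
    where open ≤-Reasoning

  stage₀ : TreeStage S₀ 0
  stage₀ = record { cliques = λ _ → C₀ ; tree = single-block S₀ ; shape = shape₀ ; missing = missing }
    where
    missing : ∃ λ x → S₀ x ≡ false
    missing with full-or-missing S₀
    ... | inj₂ outside = outside
    ... | inj₁ full = contradiction (trans (sym (count-all S₀ full)) (count-members C₀)) (>⇒≢ k<n)

  extremal-structure : edgeCount G ≡ target → ExtremalStructure
  extremal-structure edges≡target = phase-one n stage₀ (m≤n+m n (count S₀)) (begin
    edgeCount G + minEdges K 0 K   ≡⟨ cong₂ _+_ edges≡target minEdges-start ⟩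
    target + edgesIn S₀            ≡⟨ +-comm target (edgesIn S₀) ⟩
    edgesIn S₀ + target            ∎)
    where open ≤-Reasoning

  structure⇒Gtree : ExtremalStructure → InGtree (suc q) (famQKL q (suc K) r) G
  structure⇒Gtree structure = hyperedges , linear , hypertree connected , covers-edges , induced
    where
    open ExtremalStructure structure
    -- famQKL puts L at the last index, so the host block is moved there.
    open Relabelled tree (transpose host (fromℕ q))
    σ : Fin (suc q) → Fin (suc q)
    σ = PC.transpose host (fromℕ q)
    induced : ∀ i → InducedIso G (hyperedges i) (famQKL q (suc K) r i)
    induced i with i ≟ fromℕ q
    ... | yes refl = LCopy.induced-L forms-L _ λ x →
      trans (cong (λ j → members (cliques j) x ∨ (does (j ≟ host) ∧ members partner x))
                  (transpose-target host (fromℕ q)))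
            (cong (λ b → members (cliques host) x ∨ (b ∧ members partner x)) (dec-true (host ≟ host) refl))
    ... | no i≢last = induced-K (cliques (σ i)) _ λ x →
      trans (cong (λ b → members (cliques (σ i)) x ∨ (b ∧ members partner x)) (dec-false (σ i ≟ host) σi≢host))
            (∨-identityʳ (members (cliques (σ i)) x))
      where
      σi≢host : ¬ σ i ≡ host
      σi≢host σi≡host = i≢last (π-injective (trans σi≡host (sym (transpose-target host (fromℕ q)))))

  Gtree⇒edgeCount : InGtree (suc q) (famQKL q (suc K) r) G → edgeCount G ≡ target
  Gtree⇒edgeCount in-Gtree = trans (edgeCount-Gtree G q (suc K) r in-Gtree) (Gtree-edgeCount≡minEdges K q r r≤K)

size-in-digits : ∀ {n} K q r → 1 ≤ r → n ∸ suc K ≡ q * K + r → n ≡ suc (suc q * K + r)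
size-in-digits {n} K q r 1≤r n∸k≡ = begin
  n                          ≡⟨ m+[n∸m]≡n k≤n ⟨
  suc K + (n ∸ suc K)        ≡⟨ cong (suc K +_) n∸k≡ ⟩
  suc K + (q * K + r)        ≡⟨ cong suc (+-assoc K (q * K) r) ⟨
  suc (suc q * K + r)        ∎
  where
  open ≡-Reasoning
  k≤n : suc K ≤ n
  k≤n = <⇒≤ (m∸n≢0⇒n<m λ n∸k≡0 →
    <⇒≢ (≤-trans 1≤r (m≤n+m r (q * K))) (sym (trans (sym n∸k≡) n∸k≡0)))

theorem1p4 : (k n q r : ℕ) (G : Graph n) →
    3 ≤ k → Connected G → HasK1Cover k G →
    1 ≤ r → r ≤ k ∸ 1 → n ∸ k ≡ q * (k ∸ 1) + r →
    ((q + 2) * (k C 2) ∸ ((k ∸ r) C 2) ≤ edgeCount G)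
    × ((edgeCount G ≡ (q + 2) * (k C 2) ∸ ((k ∸ r) C 2))
    ⇔ InGtree (suc q) (famQKL q k r) G)
theorem1p4 zero n q r G () connected cover 1≤r r≤K n∸k≡
theorem1p4 (suc K) n q r G _ connected cover 1≤r r≤K n∸k≡ =
  subst (_≤ edgeCount G) (sym bound≡target) target≤edgeCount ,
  mk⇔ (λ tight → structure⇒Gtree (extremal-structure (trans tight bound≡target)))
      (λ in-Gtree → trans (Gtree⇒edgeCount in-Gtree) (sym bound≡target))
  where
  open Proof K G connected cover q r (size-in-digits K q r 1≤r n∸k≡) 1≤r r≤K
  bound≡target : (q + 2) * (suc K C 2) ∸ ((suc K ∸ r) C 2) ≡ target
  bound≡target = minEdges≡bound K q r r≤K
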